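{- For $n\ge1$, the average value of the subtree number index over the set $G_n$ of all spiro chains with $n$ hexagons is \[ STN_{avr}(G_n)=\frac{1}{|G_n|}\sum_{G\in G_n}STN(G)=\frac{900}{361}\Big(\frac{41}{3}\Big)^n+\frac{130}{38}n-\frac{539}{361}. \]
   Context: $STN(G)$ is the number of nonempty subtrees (subgraphs that are trees, single vertices included) of a graph $G$. A spiro chain with $n$ hexagons consists of hexagons $H_1,\dots,H_n$ such that $H_i$ and $H_{i+1}$ share exactly one vertex $c_i$, non-consecutive hexagons are disjoint, and for $2\le i\le n-1$ the vertices $c_{i-1}\ne c_i$ are at distance $d_i\in\{1,2,3\}$ in $H_i$. The set $G_n$ consists of the chains corresponding to all sequences $(d_2,\dots,d_{n-1})\in\{1,2,3\}^{n-2}$, each sequence counted once (so the average equals the expected value of $STN$ when each $d_i$ is independently uniform on $\{1,2,3\}$). -}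

module Defs where

open import Data.Bool using (Bool; true; false; _∧_; _∨_; not; if_then_else_)
open import Data.Nat using (ℕ; zero; suc; _+_; _*_; _∸_; _^_; _≡ᵇ_; NonZero)
open import Data.Nat.Properties using (m^n≢0)
open import Data.Fin using (Fin; toℕ)
open import Data.List using (List; []; _∷_; _++_; map; length; filter; foldr; concatMap; upTo)
open import Data.Bool.ListAction using (any; all)
open import Data.Nat.ListAction using (sum)
open import Data.Vec using (Vec; toList)
import Data.Vec as Vec
open import Data.Product using (_×_; _,_; proj₁; proj₂)
open import Data.Integer using (ℤ; +_)
open import Data.Rational using (ℚ; _/_; 1ℚ) renaming (_*_ to _*ℚ_)
open import Relation.Nullary.Decidable using (does)
open import Relation.Binary.PropositionalEquality using (_≡_)
open import Data.Bool.Properties using (T?)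
open import Data.Bool using (T)

-- Finite simple graphs: vertices 0 .. V-1 (natural-number labels),
-- edges a list of unordered pairs (each listed once).

record Graph : Set where
  constructor graph
  field
    V : ℕ
    E : List (ℕ × ℕ)
open Graph public

-- Boolean masks (subsets). A vertex subset is a List Bool of length V,
-- an edge subset is a List Bool of length (length E).

allMasks : ℕ → List (List Bool)
allMasks zero    = [] ∷ []
allMasks (suc k) = map (false ∷_) (allMasks k) ++ map (true ∷_) (allMasks k)

at : List Bool → ℕ → Bool
at []       _       = false
at (b ∷ _)  zero    = b
at (_ ∷ bs) (suc i) = at bs i

selected : {A : Set} → List Bool → List A → List A
selected []          _        = []
selected (_ ∷ _)     []       = []
selected (true ∷ m)  (x ∷ xs) = x ∷ selected m xs
selected (false ∷ m) (x ∷ xs) = selected m xs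

countTrue : List Bool → ℕ
countTrue []          = 0
countTrue (true ∷ m)  = suc (countTrue m)
countTrue (false ∷ m) = countTrue m

firstTrue : List Bool → ℕ
firstTrue []          = 0
firstTrue (true ∷ _)  = 0
firstTrue (false ∷ m) = suc (firstTrue m)

step : ℕ → List (ℕ × ℕ) → List Bool → List Bool
step V es R = map (λ v → at R v ∨ any (λ e → (at R (proj₁ e) ∧ (proj₂ e ≡ᵇ v))
                                        ∨ (at R (proj₂ e) ∧ (proj₁ e ≡ᵇ v))) es)
                  (upTo V)

iter : ℕ → (List Bool → List Bool) → List Bool → List Bool
iter zero    f x = x
iter (suc k) f x = iter k f (f x)

singleton : ℕ → ℕ → List Bool
singleton V u = map (λ v → v ≡ᵇ u) (upTo V)

-- vertices reachable from u using edges es (V iterations suffice)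
reach : ℕ → List (ℕ × ℕ) → ℕ → List Bool
reach V es u = iter V (step V es) (singleton V u)

subsetOf : ℕ → List Bool → List Bool → Bool
subsetOf V S R = all (λ v → not (at S v) ∨ at R v) (upTo V)

-- It is a tree iff it is nonempty, connected and
-- has exactly |S| - 1 edges (the standard characterization of trees).

isSubgraph : Graph → List Bool → List Bool → Bool
isSubgraph G S T = all (λ e → at S (proj₁ e) ∧ at S (proj₂ e)) (selected T (E G))

isConnected : Graph → List Bool → List Bool → Bool
isConnected G S T = subsetOf (V G) S (reach (V G) (selected T (E G)) (firstTrue S))

isSubtree : Graph → List Bool → List Bool → Bool
isSubtree G S T =
  isSubgraph G S T ∧ (not (countTrue S ≡ᵇ 0))
    ∧ isConnected G S T ∧ (suc (countTrue T) ≡ᵇ countTrue S)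

allPairs : Graph → List (List Bool × List Bool)
allPairs G = concatMap (λ S → map (S ,_) (allMasks (length (E G)))) (allMasks (V G))

STN : Graph → ℕ
STN G = length (filter (λ p → T? (isSubtree G (proj₁ p) (proj₂ p))) (allPairs G))

-- Spiro chains.
-- A hexagon with entry vertex e and five fresh vertices b, b+1, ..., b+4,
-- in cyclic order e, b, b+1, b+2, b+3, b+4, e.
hexEdges : ℕ → ℕ → List (ℕ × ℕ)
hexEdges e b = (e , b) ∷ (b , suc b) ∷ (suc b , 2 + b) ∷ (2 + b , 3 + b)
             ∷ (3 + b , 4 + b) ∷ (4 + b , e) ∷ []

-- hexagons H_2, ..., H_n: H entered at e with fresh labels b..b+4; a code
-- d ∈ Fin 3 means the next cut vertex is at distance toℕ d + 1 ∈ {1,2,3}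
-- from e (namely vertex b + toℕ d).
tailEdges : ℕ → ℕ → List (Fin 3) → List (ℕ × ℕ)
tailEdges e b []       = hexEdges e b
tailEdges e b (d ∷ ds) = hexEdges e b ++ tailEdges (b + toℕ d) (5 + b) ds

-- spiro chain with n hexagons given (d_2,...,d_{n-1}) (coded in Fin 3,
-- d_i = toℕ code + 1).  H_1 = hexagon on 0..5, c_1 = 0.
spiroEdges : (n : ℕ) → Vec (Fin 3) (n ∸ 2) → List (ℕ × ℕ)
spiroEdges zero          _  = []
spiroEdges (suc zero)    _  = hexEdges 0 1
spiroEdges (suc (suc k)) ds = hexEdges 0 1 ++ tailEdges 0 6 (toList ds)

spiro : (n : ℕ) → Vec (Fin 3) (n ∸ 2) → Graph
spiro n ds = graph (1 + 5 * n) (spiroEdges n ds)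

allSeqs : (k : ℕ) → List (Vec (Fin 3) k)
allSeqs zero    = Vec.[] ∷ []
allSeqs (suc k) = concatMap (λ d → map (d Vec.∷_) (allSeqs k))
                            (Data.Fin.zero ∷ Data.Fin.suc Data.Fin.zero
                              ∷ Data.Fin.suc (Data.Fin.suc Data.Fin.zero) ∷ [])

-- |G_n| = 3^(n-2) (= 1 for n = 1)
cardG : ℕ → ℕ
cardG n = 3 ^ (n ∸ 2)

cardG-nonZero : ∀ n → NonZero (cardG n)
cardG-nonZero n = m^n≢0 3 (n ∸ 2)

totalSTN : ℕ → ℕ
totalSTN n = sum (map (λ ds → STN (spiro n ds)) (allSeqs (n ∸ 2)))

STNavr : ℕ → ℚ
STNavr n = _/_ (+ totalSTN n) (cardG n) {{cardG-nonZero n}}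

_^ℚ_ : ℚ → ℕ → ℚ
q ^ℚ zero  = 1ℚ
q ^ℚ suc k = q *ℚ (q ^ℚ k)

-- A spiro chain with k + 3 hexagons is obtained from one with k + 2 by gluing a
-- hexagon at a vertex x of its last hexagon.  A subtree of the glued graph lies in
-- the old graph, or in the new hexagon avoiding x (15 of these), or is a subtree of
-- the old graph through x extended by a subtree of the hexagon through x (20
-- extensions); so STN grows by 15 + 20 N, where N counts the old subtrees through
-- x.  The same decomposition gives the count through the next cut vertex, at
-- distance d from x, as a_d + b_d N with (a_d , b_d) = (5 , 16), (8 , 13), (9 , 12).
-- Summing over all 3 ^ k chains yields the linear recurrences
--   S (k + 1) = 3 S k + 45 · 3 ^ k + 20 U k,   U (k + 1) = 66 · 3 ^ k + 41 U k
-- with S 0 = 471 and U 0 = 883; their solution divided by 3 ^ k is the average.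

module Submission where

open import Defs

-- a separate module, so that its ℕ operators do not clash with the ℚ operators of
-- the statement below
module Counting where

  open import Data.Bool using (Bool; true; false; _∧_; _∨_; not; T)
  open import Data.Bool.Properties using (T?; ∧-conicalˡ; ∧-conicalʳ; ∧-zeroʳ)
  open import Data.Bool.ListAction using (any; all)
  open import Data.Empty using (⊥; ⊥-elim)
  open import Data.Fin as Fin using (Fin; toℕ)
  open import Data.Fin.Properties using (toℕ<n)
  open import Data.List using (List; []; _∷_; _++_; map; length; filter; concat; concatMap; applyUpTo)
  open import Data.List.Properties using (++-assoc; length-++; length-map)
  open import Data.List.Relation.Unary.All using (All; []; _∷_)
  open import Data.List.Relation.Unary.All.Properties using () renaming (++⁺ to All-++⁺)
  open import Data.List.Relation.Unary.Any using (Any; here; there)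
  open import Data.List.Relation.Unary.Any.Properties using (++⁻; ++⁺ˡ; ++⁺ʳ)
  open import Data.Nat using (ℕ; zero; suc; _+_; _*_; _∸_; _^_; _≤_; _<_; z≤n; s≤s; _≡ᵇ_; _≤ᵇ_; _<?_; _≟_)
  open import Data.Nat.ListAction using (sum)
  open import Data.Nat.Properties
  open import Data.Nat.Solver using (module +-*-Solver)
  open import Data.Product using (_×_; _,_; proj₁; proj₂; ∃-syntax)
  open import Data.Sum using (_⊎_; inj₁; inj₂)
  open import Data.Vec using (Vec; toList; _∷ʳ_; initLast)
  open import Data.Vec.Properties using (toList-∷ʳ; length-toList)
  open import Function using (_∘_; id)
  open import Relation.Binary.PropositionalEquality
  open import Relation.Nullary using (yes; no; Dec)

  true≢false : true ≢ false
  true≢false ()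

  ∨-true : ∀ a b → a ∨ b ≡ true → a ≡ true ⊎ b ≡ true
  ∨-true true  _ _ = inj₁ refl
  ∨-true false _ h = inj₂ h

  ∨-trueʳ : ∀ a {b} → b ≡ true → a ∨ b ≡ true
  ∨-trueʳ true  _ = refl
  ∨-trueʳ false h = h

  ∧-true⁻ : ∀ a {b} → a ∧ b ≡ true → a ≡ true × b ≡ true
  ∧-true⁻ true h = refl , h

  ∧-true : ∀ {a b} → a ≡ true → b ≡ true → a ∧ b ≡ true
  ∧-true refl refl = refl

  bool-ext : ∀ {a b} → (a ≡ true → b ≡ true) → (b ≡ true → a ≡ true) → a ≡ b
  bool-ext {true}  f _ = sym (f refl)
  bool-ext {false} {true}  _ g = g refl
  bool-ext {false} {false} _ _ = refl

  ⇒-true : ∀ a b c → (not (a ∧ b) ∨ c) ≡ true → a ≡ true → b ≡ true → c ≡ true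
  ⇒-true true true c h refl refl = h

  ≡ᵇ-refl : ∀ m → (m ≡ᵇ m) ≡ true
  ≡ᵇ-refl zero    = refl
  ≡ᵇ-refl (suc m) = ≡ᵇ-refl m

  ≡ᵇ-sound : ∀ m n → (m ≡ᵇ n) ≡ true → m ≡ n
  ≡ᵇ-sound m n h = ≡ᵇ⇒≡ m n (subst T (sym h) _)

  ≤ᵇ-sound : ∀ m n → (m ≤ᵇ n) ≡ true → m ≤ n
  ≤ᵇ-sound m n h = ≤ᵇ⇒≤ m n (subst T (sym h) _)

  𝟙 : Bool → ℕ
  𝟙 true  = 1
  𝟙 false = 0

  𝟙-∧ : ∀ a b → 𝟙 (a ∧ b) ≡ 𝟙 a * 𝟙 b
  𝟙-∧ true  b = sym (+-identityʳ (𝟙 b))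
  𝟙-∧ false b = refl

  private variable A B : Set

  ∑ : List A → (A → ℕ) → ℕ
  ∑ []       f = 0
  ∑ (x ∷ xs) f = f x + ∑ xs f

  sum-map : (xs : List A) (f : A → ℕ) → sum (map f xs) ≡ ∑ xs f
  sum-map []       f = refl
  sum-map (x ∷ xs) f = cong (f x +_) (sum-map xs f)

  length-filter-𝟙 : (xs : List A) (p : A → Bool) → length (filter (T? ∘ p) xs) ≡ ∑ xs (𝟙 ∘ p)
  length-filter-𝟙 []       p = refl
  length-filter-𝟙 (x ∷ xs) p with p x
  ... | true  = cong suc (length-filter-𝟙 xs p)
  ... | false = length-filter-𝟙 xs p

  ∑-cong : (xs : List A) {f g : A → ℕ} → (∀ x → f x ≡ g x) → ∑ xs f ≡ ∑ xs g
  ∑-cong []       e = refl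
  ∑-cong (x ∷ xs) e = cong₂ _+_ (e x) (∑-cong xs e)

  ∑-++ : (xs ys : List A) (f : A → ℕ) → ∑ (xs ++ ys) f ≡ ∑ xs f + ∑ ys f
  ∑-++ []       ys f = refl
  ∑-++ (x ∷ xs) ys f = trans (cong (f x +_) (∑-++ xs ys f)) (sym (+-assoc (f x) _ _))

  ∑-+ : (xs : List A) (f g : A → ℕ) → ∑ xs (λ x → f x + g x) ≡ ∑ xs f + ∑ xs g
  ∑-+ []       f g = refl
  ∑-+ (x ∷ xs) f g = trans (cong (f x + g x +_) (∑-+ xs f g)) (+-+-comm (f x) (g x) _ _)
    where
    +-+-comm : ∀ a b c d → a + b + (c + d) ≡ a + c + (b + d)
    +-+-comm = solve 4 (λ a b c d → a :+ b :+ (c :+ d) := a :+ c :+ (b :+ d)) refl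
      where open +-*-Solver

  ∑-*ˡ : (xs : List A) (c : ℕ) (f : A → ℕ) → ∑ xs (λ x → c * f x) ≡ c * ∑ xs f
  ∑-*ˡ []       c f = sym (*-zeroʳ c)
  ∑-*ˡ (x ∷ xs) c f = trans (cong (c * f x +_) (∑-*ˡ xs c f)) (sym (*-distribˡ-+ c (f x) _))

  ∑-*ʳ : (xs : List A) (c : ℕ) (f : A → ℕ) → ∑ xs (λ x → f x * c) ≡ ∑ xs f * c
  ∑-*ʳ xs c f = trans (∑-cong xs (λ x → *-comm (f x) c)) (trans (∑-*ˡ xs c f) (*-comm c _))

  ∑-const : (xs : List A) (c : ℕ) → ∑ xs (λ _ → c) ≡ length xs * c
  ∑-const []       c = refl
  ∑-const (x ∷ xs) c = cong (c +_) (∑-const xs c)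

  ∑-map : (g : A → B) (xs : List A) (f : B → ℕ) → ∑ (map g xs) f ≡ ∑ xs (f ∘ g)
  ∑-map g []       f = refl
  ∑-map g (x ∷ xs) f = cong (f (g x) +_) (∑-map g xs f)

  ∑-concatMap : (g : A → List B) (xs : List A) (f : B → ℕ) →
                ∑ (concatMap g xs) f ≡ ∑ xs (λ x → ∑ (g x) f)
  ∑-concatMap g []       f = refl
  ∑-concatMap g (x ∷ xs) f =
    trans (∑-++ (g x) (concat (map g xs)) f) (cong (∑ (g x) f +_) (∑-concatMap g xs f))

  ∑-comm : (xs : List A) (ys : List B) (f : A → B → ℕ) →
           ∑ xs (λ x → ∑ ys (f x)) ≡ ∑ ys (λ y → ∑ xs (λ x → f x y))
  ∑-comm []       ys f = sym (trans (∑-const ys 0) (*-zeroʳ (length ys)))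
  ∑-comm (x ∷ xs) ys f =
    trans (cong (∑ ys (f x) +_) (∑-comm xs ys f)) (sym (∑-+ ys (f x) (λ y → ∑ xs (λ x′ → f x′ y))))

  ∑ᴹ : ℕ → (List Bool → ℕ) → ℕ
  ∑ᴹ k = ∑ (allMasks k)

  ∑ᴹ-suc : ∀ k (f : List Bool → ℕ) → ∑ᴹ (suc k) f ≡ ∑ᴹ k (f ∘ (false ∷_)) + ∑ᴹ k (f ∘ (true ∷_))
  ∑ᴹ-suc k f = trans (∑-++ (map (false ∷_) (allMasks k)) _ f)
                     (cong₂ _+_ (∑-map (false ∷_) (allMasks k) f) (∑-map (true ∷_) (allMasks k) f))

  ∑ᴹ-cong : ∀ k {f g : List Bool → ℕ} → (∀ m → length m ≡ k → f m ≡ g m) → ∑ᴹ k f ≡ ∑ᴹ k g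
  ∑ᴹ-cong zero    e = cong (_+ 0) (e [] refl)
  ∑ᴹ-cong (suc k) {f} {g} e = begin
    ∑ᴹ (suc k) f
      ≡⟨ ∑ᴹ-suc k f ⟩
    ∑ᴹ k (f ∘ (false ∷_)) + ∑ᴹ k (f ∘ (true ∷_))
      ≡⟨ cong₂ _+_ (∑ᴹ-cong k (λ m p → e (false ∷ m) (cong suc p))) (∑ᴹ-cong k (λ m p → e (true ∷ m) (cong suc p))) ⟩
    ∑ᴹ k (g ∘ (false ∷_)) + ∑ᴹ k (g ∘ (true ∷_))
      ≡⟨ sym (∑ᴹ-suc k g) ⟩
    ∑ᴹ (suc k) g ∎
    where open ≡-Reasoning

  ∑ᴹ-++ : ∀ a b (f : List Bool → ℕ) → ∑ᴹ (a + b) f ≡ ∑ᴹ a (λ S → ∑ᴹ b (λ s → f (S ++ s)))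
  ∑ᴹ-++ zero    b f = sym (+-identityʳ _)
  ∑ᴹ-++ (suc a) b f = begin
    ∑ᴹ (suc a + b) f
      ≡⟨ ∑ᴹ-suc (a + b) f ⟩
    ∑ᴹ (a + b) (f ∘ (false ∷_)) + ∑ᴹ (a + b) (f ∘ (true ∷_))
      ≡⟨ cong₂ _+_ (∑ᴹ-++ a b (f ∘ (false ∷_))) (∑ᴹ-++ a b (f ∘ (true ∷_))) ⟩
    ∑ᴹ a (λ S → ∑ᴹ b (λ s → f (false ∷ S ++ s))) + ∑ᴹ a (λ S → ∑ᴹ b (λ s → f (true ∷ S ++ s)))
      ≡⟨ sym (∑ᴹ-suc a (λ S → ∑ᴹ b (λ s → f (S ++ s)))) ⟩
    ∑ᴹ (suc a) (λ S → ∑ᴹ b (λ s → f (S ++ s))) ∎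
    where open ≡-Reasoning

  all-++ : (p : A → Bool) (xs ys : List A) → all p (xs ++ ys) ≡ all p xs ∧ all p ys
  all-++ p []       ys = refl
  all-++ p (x ∷ xs) ys rewrite all-++ p xs ys with p x
  ... | true  = refl
  ... | false = refl

  all-map : (p : B → Bool) (g : A → B) (xs : List A) → all p (map g xs) ≡ all (p ∘ g) xs
  all-map p g []       = refl
  all-map p g (x ∷ xs) = cong (p (g x) ∧_) (all-map p g xs)

  all-cong : {P : A → Set} (p q : A → Bool) {xs : List A} → All P xs → (∀ x → P x → p x ≡ q x) →
             all p xs ≡ all q xs
  all-cong p q []         e = refl
  all-cong p q (px ∷ pxs) e = cong₂ _∧_ (e _ px) (all-cong p q pxs e)

  allMasks-sound : ∀ k (p : List Bool → Bool) → all p (allMasks k) ≡ true →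
                   ∀ m → length m ≡ k → p m ≡ true
  allMasks-sound zero    p h [] refl = ∧-conicalˡ (p []) true h
  allMasks-sound (suc k) p h (b ∷ m) e
    rewrite all-++ p (map (false ∷_) (allMasks k)) (map (true ∷_) (allMasks k))
          | all-map p (false ∷_) (allMasks k) | all-map p (true ∷_) (allMasks k) with b
  ... | false = allMasks-sound k (p ∘ (false ∷_)) (∧-conicalˡ _ _ h) m (suc-injective e)
  ... | true  = allMasks-sound k (p ∘ (true ∷_)) (∧-conicalʳ _ _ h) m (suc-injective e)

  isEmpty : List Bool → Bool
  isEmpty m = countTrue m ≡ᵇ 0

  ∑ᴹ-isEmpty : ∀ k → ∑ᴹ k (𝟙 ∘ isEmpty) ≡ 1
  ∑ᴹ-isEmpty zero    = refl
  ∑ᴹ-isEmpty (suc k) = begin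
    ∑ᴹ (suc k) (𝟙 ∘ isEmpty)                       ≡⟨ ∑ᴹ-suc k (𝟙 ∘ isEmpty) ⟩
    ∑ᴹ k (𝟙 ∘ isEmpty) + ∑ᴹ k (λ _ → 0)           ≡⟨ cong₂ _+_ (∑ᴹ-isEmpty k) (∑-const (allMasks k) 0) ⟩
    1 + length (allMasks k) * 0                    ≡⟨ cong suc (*-zeroʳ (length (allMasks k))) ⟩
    1                                              ∎
    where open ≡-Reasoning

  isEmpty⇒countTrue≡0 : ∀ S → isEmpty S ≡ true → countTrue S ≡ 0
  isEmpty⇒countTrue≡0 S h = ≡ᵇ-sound (countTrue S) 0 h

  isEmpty⇒at≡false : ∀ S v → isEmpty S ≡ true → at S v ≡ false
  isEmpty⇒at≡false []          v       h = refl
  isEmpty⇒at≡false (false ∷ S) zero    h = refl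
  isEmpty⇒at≡false (false ∷ S) (suc v) h = isEmpty⇒at≡false S v h

  nonEmpty⇒at : ∀ S → isEmpty S ≡ false → ∃[ v ] at S v ≡ true
  nonEmpty⇒at (true ∷ S)  h = 0 , refl
  nonEmpty⇒at (false ∷ S) h with nonEmpty⇒at S h
  ... | v , e = suc v , e

  at⇒< : ∀ S v → at S v ≡ true → v < length S
  at⇒< (b ∷ S) zero    h = s≤s z≤n
  at⇒< (b ∷ S) (suc v) h = s≤s (at⇒< S v h)

  at-++ˡ : ∀ S s v → v < length S → at (S ++ s) v ≡ at S v
  at-++ˡ (b ∷ S) s zero    l       = refl
  at-++ˡ (b ∷ S) s (suc v) (s≤s l) = at-++ˡ S s v l

  at-++ʳ : ∀ S s i → at (S ++ s) (i + length S) ≡ at s i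
  at-++ʳ []      s i = cong (at s) (+-identityʳ i)
  at-++ʳ (b ∷ S) s i = trans (cong (at (b ∷ S ++ s)) (+-suc i (length S))) (at-++ʳ S s i)

  countTrue-++ : ∀ S s → countTrue (S ++ s) ≡ countTrue S + countTrue s
  countTrue-++ []          s = refl
  countTrue-++ (true ∷ S)  s = cong suc (countTrue-++ S s)
  countTrue-++ (false ∷ S) s = countTrue-++ S s

  firstTrue-≤ : ∀ S v → at S v ≡ true → firstTrue S ≤ v
  firstTrue-≤ (true ∷ S)  v       h = z≤n
  firstTrue-≤ (false ∷ S) (suc v) h = s≤s (firstTrue-≤ S v h)

  at-firstTrue : ∀ S v → at S v ≡ true → at S (firstTrue S) ≡ true
  at-firstTrue (true ∷ S)  v       h = refl
  at-firstTrue (false ∷ S) (suc v) h = at-firstTrue S v h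

  firstTrue-++ˡ : ∀ S s v → at S v ≡ true → firstTrue (S ++ s) ≡ firstTrue S
  firstTrue-++ˡ (true ∷ S)  s v       h = refl
  firstTrue-++ˡ (false ∷ S) s (suc v) h = cong suc (firstTrue-++ˡ S s v h)

  firstTrue-++ʳ : ∀ S s → isEmpty S ≡ true → firstTrue (S ++ s) ≡ length S + firstTrue s
  firstTrue-++ʳ []          s h = refl
  firstTrue-++ʳ (false ∷ S) s h = cong suc (firstTrue-++ʳ S s h)

  ++-split : ∀ a b (m : List Bool) → length m ≡ a + b →
             ∃[ S ] ∃[ s ] length S ≡ a × length s ≡ b × m ≡ S ++ s
  ++-split zero    b m       e = [] , m , refl , e , refl
  ++-split (suc a) b (x ∷ m) e with ++-split a b m (suc-injective e)
  ... | S , s , lS , ls , refl = x ∷ S , s , cong suc lS , ls , refl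

  selected-All : {P : A → Set} (T : List Bool) {xs : List A} → All P xs → All P (selected T xs)
  selected-All []          _          = []
  selected-All (b ∷ T)     []         = []
  selected-All (true ∷ T)  (px ∷ pxs) = px ∷ selected-All T pxs
  selected-All (false ∷ T) (px ∷ pxs) = selected-All T pxs

  selected-++ : (T t : List Bool) (xs ys : List A) → length T ≡ length xs →
                selected (T ++ t) (xs ++ ys) ≡ selected T xs ++ selected t ys
  selected-++ []          t []       ys e = refl
  selected-++ (true ∷ T)  t (x ∷ xs) ys e = cong (x ∷_) (selected-++ T t xs ys (suc-injective e))
  selected-++ (false ∷ T) t (x ∷ xs) ys e = selected-++ T t xs ys (suc-injective e)

  selected-map : (f : A → B) (t : List Bool) (xs : List A) → selected t (map f xs) ≡ map f (selected t xs)
  selected-map f []          xs       = refl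
  selected-map f (b ∷ t)     []       = refl
  selected-map f (true ∷ t)  (x ∷ xs) = cong (f x ∷_) (selected-map f t xs)
  selected-map f (false ∷ t) (x ∷ xs) = selected-map f t xs

  selected-isEmpty : (t : List Bool) (xs : List A) → isEmpty t ≡ true → selected t xs ≡ []
  selected-isEmpty []          xs       h = refl
  selected-isEmpty (b ∷ t)     []       h = refl
  selected-isEmpty (false ∷ t) (x ∷ xs) h = selected-isEmpty t xs h

  selected≡[]⇒isEmpty : (t : List Bool) (xs : List A) → length t ≡ length xs → selected t xs ≡ [] →
                        isEmpty t ≡ true
  selected≡[]⇒isEmpty []          []       e h = refl
  selected≡[]⇒isEmpty (false ∷ t) (x ∷ xs) e h = selected≡[]⇒isEmpty t xs (suc-injective e) h

  -- Paths and the reachability test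

  Edge : Set
  Edge = ℕ × ℕ

  Adjacent : List Edge → ℕ → ℕ → Set
  Adjacent es v w = Any (λ e → (proj₁ e ≡ v × proj₂ e ≡ w) ⊎ (proj₂ e ≡ v × proj₁ e ≡ w)) es

  infixl 5 _▸_

  data Path (es : List Edge) (u : ℕ) : ℕ → Set where
    ε   : Path es u u
    _▸_ : ∀ {v w} → Path es u v → Adjacent es v w → Path es u w

  infixl 5 _▸▸_

  _▸▸_ : ∀ {es u v w} → Path es u v → Path es v w → Path es u w
  p ▸▸ ε       = p
  p ▸▸ (q ▸ a) = (p ▸▸ q) ▸ a

  Path-map : ∀ {es fs u v} → (∀ {a b} → Adjacent es a b → Adjacent fs a b) → Path es u v → Path fs u v
  Path-map f ε       = ε
  Path-map f (p ▸ a) = Path-map f p ▸ f a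

  Bounded : ℕ → List Edge → Set
  Bounded V es = All (λ e → proj₁ e < V × proj₂ e < V) es

  Bounded-mono : ∀ {V W} {es} → V ≤ W → Bounded V es → Bounded W es
  Bounded-mono le []             = []
  Bounded-mono le ((a , b) ∷ bs) = (≤-trans a le , ≤-trans b le) ∷ Bounded-mono le bs

  Adjacent-bounded : ∀ {V es v w} → Bounded V es → Adjacent es v w → v < V × w < V
  Adjacent-bounded (_ ∷ bs)       (there a)                 = Adjacent-bounded bs a
  Adjacent-bounded ((l₁ , l₂) ∷ _) (here (inj₁ (refl , refl))) = l₁ , l₂
  Adjacent-bounded ((l₁ , l₂) ∷ _) (here (inj₂ (refl , refl))) = l₂ , l₁

  Path-closed : ∀ S es → all (λ e → at S (proj₁ e) ∧ at S (proj₂ e)) es ≡ true →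
                ∀ {a b} → at S a ≡ true → Path es a b → at S b ≡ true
  Path-closed S es h ha ε       = ha
  Path-closed S es h ha (p ▸ a) = adjacent-closed es h a
    where
    adjacent-closed : ∀ es → all (λ e → at S (proj₁ e) ∧ at S (proj₂ e)) es ≡ true →
                      ∀ {v w} → Adjacent es v w → at S w ≡ true
    adjacent-closed (e ∷ es)       h (there a) = adjacent-closed es (∧-conicalʳ _ _ h) a
    adjacent-closed ((p , q) ∷ es) h (here (inj₁ (refl , refl))) = ∧-conicalʳ (at S p) _ (∧-conicalˡ _ _ h)
    adjacent-closed ((p , q) ∷ es) h (here (inj₂ (refl , refl))) = ∧-conicalˡ (at S p) _ (∧-conicalˡ _ _ h)

  at-tabulate : ∀ n (f : ℕ → Bool) (g : ℕ → ℕ) v → at (map f (applyUpTo g n)) v ≡ true → v < n × f (g v) ≡ true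
  at-tabulate (suc n) f g zero    h = s≤s z≤n , h
  at-tabulate (suc n) f g (suc v) h with at-tabulate n f (g ∘ suc) v h
  ... | l , e = s≤s l , e

  at-tabulate⁺ : ∀ n (f : ℕ → Bool) (g : ℕ → ℕ) v → v < n → f (g v) ≡ true → at (map f (applyUpTo g n)) v ≡ true
  at-tabulate⁺ (suc n) f g zero    _       h = h
  at-tabulate⁺ (suc n) f g (suc v) (s≤s l) h = at-tabulate⁺ n f (g ∘ suc) v l h

  all-tabulate : ∀ n (p : ℕ → Bool) (g : ℕ → ℕ) → all p (applyUpTo g n) ≡ true → ∀ v → v < n → p (g v) ≡ true
  all-tabulate (suc n) p g h zero    _       = ∧-conicalˡ _ _ h
  all-tabulate (suc n) p g h (suc v) (s≤s l) = all-tabulate n p (g ∘ suc) (∧-conicalʳ _ _ h) v l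

  all-tabulate⁺ : ∀ n (p : ℕ → Bool) (g : ℕ → ℕ) → (∀ v → v < n → p (g v) ≡ true) → all p (applyUpTo g n) ≡ true
  all-tabulate⁺ zero    p g h = refl
  all-tabulate⁺ (suc n) p g h = ∧-true (h 0 (s≤s z≤n)) (all-tabulate⁺ n p (g ∘ suc) (λ v l → h (suc v) (s≤s l)))

  module _ (V : ℕ) (es : List Edge) where

    private
      crosses : List Bool → ℕ → Edge → Bool
      crosses R w e = (at R (proj₁ e) ∧ (proj₂ e ≡ᵇ w)) ∨ (at R (proj₂ e) ∧ (proj₁ e ≡ᵇ w))

    step-sound : ∀ R w → at (step V es R) w ≡ true →
                 w < V × (at R w ≡ true ⊎ ∃[ a ] at R a ≡ true × Adjacent es a w)
    step-sound R w h with at-tabulate V _ id w h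
    ... | l , h′ with ∨-true (at R w) _ h′
    ...   | inj₁ a = l , inj₁ a
    ...   | inj₂ b = l , inj₂ (crossing es (any-true es b))
      where
      any-true : ∀ es → any (crosses R w) es ≡ true → Any (λ e → crosses R w e ≡ true) es
      any-true (e ∷ es) h with ∨-true (crosses R w e) _ h
      ... | inj₁ c = here c
      ... | inj₂ c = there (any-true es c)
      crossing : ∀ es → Any (λ e → crosses R w e ≡ true) es → ∃[ a ] at R a ≡ true × Adjacent es a w
      crossing (e ∷ es) (there c) with crossing es c
      ... | a , r , adj = a , r , there adj
      crossing ((p , q) ∷ es) (here c) with ∨-true (at R p ∧ (q ≡ᵇ w)) _ c
      ... | inj₁ d = p , ∧-conicalˡ _ _ d , here (inj₁ (refl , ≡ᵇ-sound q w (∧-conicalʳ _ _ d)))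
      ... | inj₂ d = q , ∧-conicalˡ _ _ d , here (inj₂ (refl , ≡ᵇ-sound p w (∧-conicalʳ _ _ d)))

    step-⊇ : ∀ R w → w < V → at R w ≡ true → at (step V es R) w ≡ true
    step-⊇ R w l h = at-tabulate⁺ V _ id w l (subst (λ b → b ∨ any (crosses R w) es ≡ true) (sym h) refl)

    step-adjacent : ∀ R a w → w < V → at R a ≡ true → Adjacent es a w → at (step V es R) w ≡ true
    step-adjacent R a w l h adj = at-tabulate⁺ V _ id w l (∨-trueʳ (at R w) (any-true es adj))
      where
      any-true : ∀ es → Adjacent es a w → any (crosses R w) es ≡ true
      any-true (e ∷ es) (there x) = ∨-trueʳ (crosses R w e) (any-true es x)
      any-true ((p , q) ∷ es) (here (inj₁ (refl , refl))) rewrite h | ≡ᵇ-refl q = refl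
      any-true ((p , q) ∷ es) (here (inj₂ (refl , refl))) rewrite h | ≡ᵇ-refl p =
        cong (_∨ _) (∨-trueʳ (at R p ∧ (q ≡ᵇ p)) refl)

    singleton-sound : ∀ u w → at (singleton V u) w ≡ true → w < V × w ≡ u
    singleton-sound u w h with at-tabulate V (_≡ᵇ u) id w h
    ... | l , e = l , ≡ᵇ-sound w u e

    singleton-∋ : ∀ u → u < V → at (singleton V u) u ≡ true
    singleton-∋ u l = at-tabulate⁺ V (_≡ᵇ u) id u l (≡ᵇ-refl u)

    iter-step-sound : ∀ u k X → (∀ w → at X w ≡ true → Path es u w × w < V) →
                      ∀ v → at (iter k (step V es) X) v ≡ true → Path es u v × v < V
    iter-step-sound u zero    X hX = hX
    iter-step-sound u (suc k) X hX = iter-step-sound u k (step V es X) hS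
      where
      hS : ∀ w → at (step V es X) w ≡ true → Path es u w × w < V
      hS w h with step-sound X w h
      ... | l , inj₁ a             = proj₁ (hX w a) , l
      ... | l , inj₂ (a , ra , adj) = proj₁ (hX a ra) ▸ adj , l

    iter-singleton-sound : ∀ u k v → at (iter k (step V es) (singleton V u)) v ≡ true → Path es u v × v < V
    iter-singleton-sound u k = iter-step-sound u k (singleton V u) start
      where
      start : ∀ w → at (singleton V u) w ≡ true → Path es u w × w < V
      start w h with singleton-sound u w h
      ... | l , refl = ε , l

    reach-sound : ∀ u v → at (reach V es u) v ≡ true → Path es u v × v < V
    reach-sound u = iter-singleton-sound u V

  count : ℕ → (ℕ → Bool) → ℕ
  count zero    f = 0
  count (suc n) f = 𝟙 (f n) + count n f

  count-false : ∀ n → count n (λ _ → false) ≡ 0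
  count-false zero    = refl
  count-false (suc n) = count-false n

  count-≤ : ∀ n f → count n f ≤ n
  count-≤ zero    f = z≤n
  count-≤ (suc n) f = +-mono-≤ (𝟙≤1 (f n)) (count-≤ n f)
    where
    𝟙≤1 : ∀ b → 𝟙 b ≤ 1
    𝟙≤1 true  = s≤s z≤n
    𝟙≤1 false = z≤n

  𝟙-mono : ∀ a b → (a ≡ true → b ≡ true) → 𝟙 a ≤ 𝟙 b
  𝟙-mono true  b h rewrite h refl = s≤s z≤n
  𝟙-mono false b h = z≤n

  _⊆_below_ : (ℕ → Bool) → (ℕ → Bool) → ℕ → Set
  f ⊆ g below n = ∀ v → v < n → f v ≡ true → g v ≡ true

  count-mono : ∀ n f g → f ⊆ g below n → count n f ≤ count n g
  count-mono zero    f g h = z≤n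
  count-mono (suc n) f g h = +-mono-≤ (𝟙-mono (f n) (g n) (h n ≤-refl)) (count-mono n f g (λ v l → h v (m≤n⇒m≤1+n l)))

  count-strict : ∀ n f g → f ⊆ g below n → ∀ w → w < n → g w ≡ true → f w ≡ false → count n f < count n g
  count-strict (suc n) f g h w l gw fw with w ≟ n
  ... | yes refl rewrite gw | fw = s≤s (count-mono n f g (λ v l → h v (m≤n⇒m≤1+n l)))
  ... | no w≢n = subst (_≤ 𝟙 (g n) + count n g) (+-suc (𝟙 (f n)) (count n f))
                   (+-mono-≤ (𝟙-mono (f n) (g n) (h n ≤-refl))
                     (count-strict n f g (λ v l → h v (m≤n⇒m≤1+n l)) w (≤∧≢⇒< (≤-pred l) w≢n) gw fw))

  ⊆-or-witness : ∀ n (f g : ℕ → Bool) → g ⊆ f below n ⊎ ∃[ w ] w < n × g w ≡ true × f w ≡ false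
  ⊆-or-witness zero    f g = inj₁ (λ v ())
  ⊆-or-witness (suc n) f g with ⊆-or-witness n f g
  ... | inj₂ (w , l , gw , fw) = inj₂ (w , m≤n⇒m≤1+n l , gw , fw)
  ... | inj₁ h with g n in gn | f n in fn
  ...   | true  | false = inj₂ (n , ≤-refl , gn , fn)
  ...   | false | _     = inj₁ (extend λ gn≡true → ⊥-elim (true≢false (trans (sym gn≡true) gn)))
    where
    extend : (g n ≡ true → f n ≡ true) → g ⊆ f below suc n
    extend hn v l gv with v ≟ n
    ... | yes refl = hn gv
    ... | no v≢n   = h v (≤∧≢⇒< (≤-pred l) v≢n) gv
  ...   | true  | true  = inj₁ extend
    where
    extend : g ⊆ f below suc n
    extend v l gv with v ≟ n
    ... | yes refl = fn
    ... | no v≢n   = h v (≤∧≢⇒< (≤-pred l) v≢n) gv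

  iter-suc : ∀ k (f : List Bool → List Bool) x → iter (suc k) f x ≡ f (iter k f x)
  iter-suc zero    f x = refl
  iter-suc (suc k) f x = iter-suc k f (f x)

  -- The k-th iterate either is already closed under one step or has more than k
  -- elements; since it has at most V elements it is closed after V steps.
  module _ (V : ℕ) (es : List Edge) (bounded : Bounded V es) (u : ℕ) (u<V : u < V) where

    private
      ball : ℕ → List Bool
      ball k = iter k (step V es) (singleton V u)

      Closed : List Bool → Set
      Closed X = (at (step V es X)) ⊆ (at X) below V

      ball-bounded : ∀ k v → at (ball k) v ≡ true → v < V
      ball-bounded k v h = proj₂ (iter-singleton-sound V es u k v h)

      ball-mono : ∀ d k v → at (ball k) v ≡ true → at (ball (d + k)) v ≡ true
      ball-mono zero    k v h = h
      ball-mono (suc d) k v h = subst (λ X → at X v ≡ true) (sym (iter-suc (d + k) (step V es) (singleton V u)))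
                                  (step-⊇ V es (ball (d + k)) v (ball-bounded (d + k) v h′) h′)
        where
        h′ = ball-mono d k v h

      closed-path : ∀ X → Closed X → ∀ {a v} → at X a ≡ true → Path es a v → at X v ≡ true
      closed-path X c h ε       = h
      closed-path X c h (p ▸ a) with Adjacent-bounded bounded a
      ... | _ , l = c _ l (step-adjacent V es X _ _ l (closed-path X c h p) a)

      closed-or-large : ∀ k → (∃[ j ] j ≤ k × Closed (ball j)) ⊎ k < count V (at (ball k))
      closed-or-large zero = inj₂ (subst (_< count V (at (ball 0))) (count-false V)
                                     (count-strict V (λ _ → false) (at (ball 0)) (λ _ _ ()) u u<V
                                       (singleton-∋ V es u u<V) refl))
      closed-or-large (suc k) with closed-or-large k
      ... | inj₁ (j , l , c) = inj₁ (j , m≤n⇒m≤1+n l , c)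
      ... | inj₂ large with ⊆-or-witness V (at (ball k)) (at (step V es (ball k)))
      ...   | inj₁ c = inj₁ (k , n≤1+n k , c)
      ...   | inj₂ (w , l , new , old) =
              inj₂ (≤-trans (s≤s large)
                     (subst (λ X → count V (at (ball k)) < count V (at X)) (sym (iter-suc k (step V es) (singleton V u)))
                       (count-strict V _ _ (λ v l → step-⊇ V es (ball k) v l) w l new old)))

    reach-complete : ∀ v → Path es u v → at (reach V es u) v ≡ true
    reach-complete v p with closed-or-large V
    ... | inj₂ large = ⊥-elim (<-irrefl refl (≤-trans large (count-≤ V _)))
    ... | inj₁ (j , l , c) = subst (λ k → at (ball k) v ≡ true) (m∸n+n≡m l)
            (ball-mono (V ∸ j) j v (closed-path (ball j) c u∈ball p))
      where
      u∈ball : at (ball j) u ≡ true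
      u∈ball = subst (λ k → at (ball k) u ≡ true) (+-identityʳ j) (ball-mono j 0 u (singleton-∋ V es u u<V))

  Connects : ℕ → List Edge → List Bool → Set
  Connects V es S = ∀ v → v < V → at S v ≡ true → Path es (firstTrue S) v

  isConnected-sound : ∀ G S T → isConnected G S T ≡ true → Connects (V G) (selected T (E G)) S
  isConnected-sound G S T h v l hv
    with all-tabulate (V G) (λ v → not (at S v) ∨ at (reach (V G) (selected T (E G)) (firstTrue S)) v) id h v l
  ... | r rewrite hv = proj₁ (reach-sound (V G) (selected T (E G)) (firstTrue S) v r)

  isConnected-complete : ∀ G S T → Bounded (V G) (selected T (E G)) → Connects (V G) (selected T (E G)) S →
                         isConnected G S T ≡ true
  isConnected-complete G S T bounded c = all-tabulate⁺ (V G) _ id covered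
    where
    covered : ∀ v → v < V G → not (at S v) ∨ at (reach (V G) (selected T (E G)) (firstTrue S)) v ≡ true
    covered v l with at S v in hv
    ... | false = refl
    ... | true  = reach-complete (V G) (selected T (E G)) bounded (firstTrue S)
                    (≤-<-trans (firstTrue-≤ S v hv) l) v (c v l hv)

  record IsTree (G : Graph) (S T : List Bool) : Set where
    field
      subgraph  : isSubgraph G S T ≡ true
      nonEmpty  : isEmpty S ≡ false
      connected : isConnected G S T ≡ true
      edges     : suc (countTrue T) ≡ countTrue S

  isSubtree-sound : ∀ G S T → isSubtree G S T ≡ true → IsTree G S T
  isSubtree-sound G S T h with isSubgraph G S T in sg | countTrue S ≡ᵇ 0 in ne | isConnected G S T in cn
  ... | true | false | true = record { subgraph = sg ; nonEmpty = ne ; connected = cn ; edges = ≡ᵇ-sound _ _ h }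

  isSubtree-complete : ∀ G S T → IsTree G S T → isSubtree G S T ≡ true
  isSubtree-complete G S T t rewrite IsTree.subgraph t | IsTree.nonEmpty t | IsTree.connected t | IsTree.edges t =
    ≡ᵇ-refl (countTrue S)

  -- Attaching a graph at a vertex

  -- We only need
  -- this for spiro chains, where it is carried along the gluings: it is what
  -- splits the edge count of a subtree between the two parts of an attachment.
  EdgeBound : Graph → Set
  EdgeBound G = ∀ S T → length S ≡ V G → length T ≡ length (E G) →
                isSubgraph G S T ≡ true → isConnected G S T ≡ true → countTrue S ≤ suc (countTrue T)

  isSubtree-empty : ∀ G S T → isEmpty S ≡ true → isSubtree G S T ≡ false
  isSubtree-empty G S T S-empty with isSubtree G S T in h
  ... | false = refl
  ... | true  = ⊥-elim (true≢false (trans (sym S-empty) (IsTree.nonEmpty (isSubtree-sound G S T h))))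

  𝟙-only₁ : ∀ {a b c} → b ≡ false → c ≡ false → 𝟙 a ≡ 𝟙 a + 𝟙 b + 𝟙 c
  𝟙-only₁ {a} refl refl = sym (trans (+-identityʳ _) (+-identityʳ (𝟙 a)))

  𝟙-only₂ : ∀ {a b c} → a ≡ false → c ≡ false → 𝟙 b ≡ 𝟙 a + 𝟙 b + 𝟙 c
  𝟙-only₂ refl refl = sym (+-identityʳ _)

  𝟙-only₃ : ∀ {a b c} → a ≡ false → b ≡ false → 𝟙 c ≡ 𝟙 a + 𝟙 b + 𝟙 c
  𝟙-only₃ refl refl = refl

  tight-sum : ∀ {a b c d} → a ≤ suc b → c ≤ d → suc (b + d) ≡ a + c → suc b ≡ a × d ≡ c
  tight-sum {a} {b} {c} {d} a≤ c≤ e = sb≡a , +-cancelˡ-≡ (suc b) d c (trans e (cong (_+ c) (sym sb≡a)))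
    where
    sb≡a : suc b ≡ a
    sb≡a = ≤-antisym (+-cancelʳ-≤ d (suc b) a (subst (_≤ a + d) (sym e) (+-monoʳ-≤ a c≤))) a≤

  Loopless : List Edge → Set
  Loopless = All (λ e → proj₁ e ≢ proj₂ e)

  attachVertex : ℕ → ℕ → ℕ → ℕ
  attachVertex x n zero    = x
  attachVertex x n (suc i) = i + n

  attachEdge : ℕ → ℕ → Edge → Edge
  attachEdge x n e = attachVertex x n (proj₁ e) , attachVertex x n (proj₂ e)

  attach : Graph → ℕ → ℕ → List Edge → Graph
  attach G x k hs = graph (V G + k) (E G ++ map (attachEdge x (V G)) hs)

  module Attaching (G : Graph) (x : ℕ) (x<V : x < V G) (k : ℕ) (hs : List Edge) (hs-bounded : Bounded (suc k) hs)
                   (hs-loopless : Loopless hs) (H-edgeBound : EdgeBound (graph (suc k) hs)) where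

    H G′ : Graph
    H  = graph (suc k) hs
    G′ = attach G x k hs

    vertex : ℕ → ℕ
    vertex = attachVertex x (V G)

    edge : Edge → Edge
    edge = attachEdge x (V G)

    vertex-new≮ : ∀ i → vertex (suc i) < V G → ⊥
    vertex-new≮ i l = <⇒≱ l (m≤n+m (V G) i)

    vertex-injective : ∀ b c → vertex b ≡ vertex c → b ≡ c
    vertex-injective zero    zero    e = refl
    vertex-injective zero    (suc j) e = ⊥-elim (vertex-new≮ j (subst (_< V G) e x<V))
    vertex-injective (suc i) zero    e = ⊥-elim (vertex-new≮ i (subst (_< V G) (sym e) x<V))
    vertex-injective (suc i) (suc j) e = cong suc (+-cancelʳ-≡ (V G) i j e)

    vertex-< : ∀ c → c < suc k → vertex c < V G + k
    vertex-< zero    l       = ≤-trans x<V (m≤m+n (V G) k)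
    vertex-< (suc i) (s≤s l) = subst (_< V G + k) (+-comm (V G) i) (+-monoʳ-< (V G) l)

    vertex-<⁻ : ∀ i → i + V G < V G + k → suc i < suc k
    vertex-<⁻ i l = s≤s (+-cancelʳ-< (V G) i k (subst (i + V G <_) (+-comm (V G) k) l))

    Bounded-edge : ∀ {fs} → Bounded (suc k) fs → Bounded (V G + k) (map edge fs)
    Bounded-edge []               = []
    Bounded-edge ((la , lb) ∷ bs) = (vertex-< _ la , vertex-< _ lb) ∷ Bounded-edge bs

    Adjacent-edge : ∀ {fs a b} → Adjacent fs a b → Adjacent (map edge fs) (vertex a) (vertex b)
    Adjacent-edge {_ ∷ fs} (there p)                   = there (Adjacent-edge p)
    Adjacent-edge {_ ∷ fs} (here (inj₁ (refl , refl))) = here (inj₁ (refl , refl))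
    Adjacent-edge {_ ∷ fs} (here (inj₂ (refl , refl))) = here (inj₂ (refl , refl))

    Adjacent-edge⁻ : ∀ fs {v w} → Adjacent (map edge fs) v w →
                     ∃[ a ] ∃[ b ] vertex a ≡ v × vertex b ≡ w × Adjacent fs a b
    Adjacent-edge⁻ (_ ∷ fs) (there p) with Adjacent-edge⁻ fs p
    ... | a , b , e₁ , e₂ , adj = a , b , e₁ , e₂ , there adj
    Adjacent-edge⁻ ((p , q) ∷ fs) (here (inj₁ (refl , refl))) = p , q , refl , refl , here (inj₁ (refl , refl))
    Adjacent-edge⁻ ((p , q) ∷ fs) (here (inj₂ (refl , refl))) = q , p , refl , refl , here (inj₂ (refl , refl))

    Path-edge : ∀ {fs a b} → Path fs a b → Path (map edge fs) (vertex a) (vertex b)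
    Path-edge ε       = ε
    Path-edge (p ▸ a) = Path-edge p ▸ Adjacent-edge a

    Path-edge⁻ : ∀ fs {a w} → Path (map edge fs) (vertex a) w → ∃[ b ] vertex b ≡ w × Path fs a b
    Path-edge⁻ fs ε = _ , refl , ε
    Path-edge⁻ fs (p ▸ adj) with Path-edge⁻ fs p
    ... | b , refl , q with Adjacent-edge⁻ fs adj
    ...   | a′ , b′ , e₁ , e₂ , adj′ with vertex-injective a′ b e₁
    ...     | refl = b′ , e₂ , q ▸ adj′

    data AttachedPath (es fs : List Edge) (u v : ℕ) : Set where
      inOld : v < V G → Path es u v → AttachedPath es fs u v
      inNew : ∀ c → vertex c ≡ v → Path es u x → Path fs 0 c → AttachedPath es fs u v

    attachedPath : ∀ es fs → Bounded (V G) es → ∀ {u v} → u < V G → Path (es ++ map edge fs) u v → AttachedPath es fs u v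
    attachedPath es fs bounded u<V ε = inOld u<V ε
    attachedPath es fs bounded u<V (p ▸ adj) with attachedPath es fs bounded u<V p | ++⁻ es adj
    ... | inOld _ q | inj₁ adjOld = inOld (proj₂ (Adjacent-bounded bounded adjOld)) (q ▸ adjOld)
    ... | inNew zero refl q _ | inj₁ adjOld = inOld (proj₂ (Adjacent-bounded bounded adjOld)) (q ▸ adjOld)
    ... | inNew (suc i) refl _ _ | inj₁ adjOld = ⊥-elim (vertex-new≮ i (proj₁ (Adjacent-bounded bounded adjOld)))
    ... | inOld l q | inj₂ adjH with Adjacent-edge⁻ fs adjH
    ...   | suc i , _ , refl , _ , _ = ⊥-elim (vertex-new≮ i l)
    ...   | zero , zero , refl , refl , _ = inOld x<V q
    ...   | zero , suc j , refl , e , adj′ = inNew (suc j) e q (ε ▸ adj′)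
    attachedPath es fs bounded u<V (p ▸ adj) | inNew c refl q r | inj₂ adjH with Adjacent-edge⁻ fs adjH
    ... | a , b , e₁ , e₂ , adj′ with vertex-injective a c e₁
    ...   | refl = inNew b e₂ q (r ▸ adj′)

    attachedPath-old : ∀ es fs → Bounded (V G) es → ∀ {u v} → u < V G → v < V G →
                       Path (es ++ map edge fs) u v → Path es u v
    attachedPath-old es fs bounded u<V v<V p with attachedPath es fs bounded u<V p
    ... | inOld _ q              = q
    ... | inNew zero refl q _    = q
    ... | inNew (suc i) refl _ _ = ⊥-elim (vertex-new≮ i v<V)

    attachedPath-new : ∀ es fs → Bounded (V G) es → ∀ {u} i → u < V G →
                       Path (es ++ map edge fs) u (i + V G) → Path es u x × Path fs 0 (suc i)
    attachedPath-new es fs bounded i u<V p with attachedPath es fs bounded u<V p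
    ... | inOld l _ = ⊥-elim (vertex-new≮ i l)
    ... | inNew c e q r with vertex-injective c (suc i) e
    ...   | refl = q , r

    root-isolated : ∀ b s t → length t ≡ length hs → isEmpty s ≡ true → isSubgraph H (b ∷ s) t ≡ true → isEmpty t ≡ true
    root-isolated b s t |t| s-empty sub = selected≡[]⇒isEmpty t hs |t| (no-edges (selected t hs) (selected-All t hs-loopless) sub)
      where
      only-root : ∀ v → at (b ∷ s) v ≡ true → v ≡ 0
      only-root zero    _ = refl
      only-root (suc v) h = ⊥-elim (true≢false (trans (sym h) (isEmpty⇒at≡false s v s-empty)))
      no-edges : ∀ es → Loopless es → all (λ e → at (b ∷ s) (proj₁ e) ∧ at (b ∷ s) (proj₂ e)) es ≡ true → es ≡ []
      no-edges []             _           _ = refl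
      no-edges ((p , q) ∷ es) (p≢q ∷ _) h = ⊥-elim (p≢q (trans (only-root p (proj₁ ends)) (sym (only-root q (proj₂ ends)))))
        where
        ends = ∧-true⁻ (at (b ∷ s) p) (proj₁ (∧-true⁻ (at (b ∷ s) p ∧ at (b ∷ s) q) h))

    module Split (bounded : Bounded (V G) (E G)) (S T s t : List Bool)
                 (|S| : length S ≡ V G) (|T| : length T ≡ length (E G)) (|s| : length s ≡ k) (|t| : length t ≡ length hs) where

      S′ T′ : List Bool
      S′ = S ++ s
      T′ = T ++ t

      oldEdges newEdges : List Edge
      oldEdges = selected T (E G)
      newEdges = selected t hs

      selected-attach : selected T′ (E G′) ≡ oldEdges ++ map edge newEdges
      selected-attach = trans (selected-++ T t (E G) (map edge hs) |T|) (cong (oldEdges ++_) (selected-map edge t hs))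

      oldEdges-bounded : Bounded (V G) oldEdges
      oldEdges-bounded = selected-All T bounded

      newEdges-bounded : Bounded (suc k) newEdges
      newEdges-bounded = selected-All t hs-bounded

      attached-bounded : Bounded (V G′) (selected T′ (E G′))
      attached-bounded = subst (Bounded (V G + k)) (sym selected-attach)
                           (All-++⁺ (Bounded-mono (m≤m+n (V G) k) oldEdges-bounded) (Bounded-edge newEdges-bounded))

      at-old : ∀ v → v < V G → at S′ v ≡ at S v
      at-old v l = at-++ˡ S s v (subst (v <_) (sym |S|) l)

      at-new : ∀ i → at S′ (i + V G) ≡ at s i
      at-new i = subst (λ n → at S′ (i + n) ≡ at s i) |S| (at-++ʳ S s i)

      at-vertex : ∀ i → at S′ (vertex i) ≡ at (at S x ∷ s) i
      at-vertex zero    = at-old x x<V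
      at-vertex (suc i) = at-new i

      isSubgraph-attach : isSubgraph G′ S′ T′ ≡ isSubgraph G S T ∧ isSubgraph H (at S x ∷ s) t
      isSubgraph-attach = begin
        all inside′ (selected T′ (E G′))                   ≡⟨ cong (all inside′) selected-attach ⟩
        all inside′ (oldEdges ++ map edge newEdges)      ≡⟨ all-++ inside′ oldEdges (map edge newEdges) ⟩
        all inside′ oldEdges ∧ all inside′ (map edge newEdges)
          ≡⟨ cong₂ _∧_ (all-cong inside′ (inside S) oldEdges-bounded
                          (λ e l → cong₂ _∧_ (at-old _ (proj₁ l)) (at-old _ (proj₂ l))))
                       (trans (all-map inside′ edge newEdges)
                              (all-cong (inside′ ∘ edge) (inside (at S x ∷ s)) newEdges-bounded
                                (λ e _ → cong₂ _∧_ (at-vertex (proj₁ e)) (at-vertex (proj₂ e))))) ⟩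
        all (inside S) oldEdges ∧ all (inside (at S x ∷ s)) newEdges ∎
        where
        open ≡-Reasoning
        inside : List Bool → Edge → Bool
        inside R e = at R (proj₁ e) ∧ at R (proj₂ e)
        inside′ = inside S′

      attached-cases : {P : ℕ → Set} → (∀ v → v < V G → at S v ≡ true → P v) →
                       (∀ i → suc i < suc k → at s i ≡ true → P (i + V G)) →
                       ∀ v → v < V G′ → at S′ v ≡ true → P v
      attached-cases {P} old new v l h = byPosition (v <? V G)
        where
        byPosition : Dec (v < V G) → P v
        byPosition (yes v<V) = old v v<V (trans (sym (at-old v v<V)) h)
        byPosition (no  v≮V) = subst P i+V≡v (new i (vertex-<⁻ i (subst (_< V G′) (sym i+V≡v) l))
                                                   (trans (sym (at-new i)) (subst (λ w → at S′ w ≡ true) (sym i+V≡v) h)))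
          where
          i = v ∸ V G
          i+V≡v = m∸n+n≡m (≮⇒≥ v≮V)

      -- the part in H of a connected subgraph of G′ that meets G
      NewPartConnected : Set
      NewPartConnected = isEmpty s ≡ true ⊎ (at S x ≡ true × isConnected H (true ∷ s) t ≡ true)

      module _ (S-nonEmpty : isEmpty S ≡ false) where

        private
          v₀ = proj₁ (nonEmpty⇒at S S-nonEmpty)
          v₀∈S = proj₂ (nonEmpty⇒at S S-nonEmpty)

        root : firstTrue S′ ≡ firstTrue S
        root = firstTrue-++ˡ S s v₀ v₀∈S

        root<V : firstTrue S < V G
        root<V = ≤-<-trans (firstTrue-≤ S v₀ v₀∈S) (subst (v₀ <_) |S| (at⇒< S v₀ v₀∈S))

        connected-attach⁻ : isConnected G′ S′ T′ ≡ true → isSubgraph G S T ≡ true →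
                            isConnected G S T ≡ true × NewPartConnected
        connected-attach⁻ c sub = connectedOld , newPartConnected (isEmpty s) refl
          where
          paths : ∀ v → v < V G′ → at S′ v ≡ true → Path (oldEdges ++ map edge newEdges) (firstTrue S) v
          paths v l h = subst₂ (λ es r → Path es r v) selected-attach root (isConnected-sound G′ S′ T′ c v l h)
          pathToNew : ∀ i → i < k → at s i ≡ true → Path oldEdges (firstTrue S) x × Path newEdges 0 (suc i)
          pathToNew i l h = attachedPath-new oldEdges newEdges oldEdges-bounded i root<V
                              (paths (i + V G) (vertex-< (suc i) (s≤s l)) (trans (at-new i) h))
          connectedOld : isConnected G S T ≡ true
          connectedOld = isConnected-complete G S T oldEdges-bounded λ v l h →
            attachedPath-old oldEdges newEdges oldEdges-bounded root<V l
              (paths v (≤-trans l (m≤m+n (V G) k)) (trans (at-old v l) h))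
          newPartConnected : ∀ b → isEmpty s ≡ b → NewPartConnected
          newPartConnected true  e = inj₁ e
          newPartConnected false e = inj₂ (x∈S (nonEmpty⇒at s e) , isConnected-complete H (true ∷ s) t newEdges-bounded hPaths)
            where
            x∈S : ∃[ i ] at s i ≡ true → at S x ≡ true
            x∈S (i , i∈s) = Path-closed S oldEdges sub (at-firstTrue S v₀ v₀∈S)
                              (proj₁ (pathToNew i (subst (i <_) |s| (at⇒< s i i∈s)) i∈s))
            hPaths : Connects (suc k) newEdges (true ∷ s)
            hPaths zero    _       _ = ε
            hPaths (suc i) (s≤s l) h = proj₂ (pathToNew i l h)

        connected-attach⁺ : isConnected G S T ≡ true → NewPartConnected → isConnected G′ S′ T′ ≡ true
        connected-attach⁺ c newConnected = isConnected-complete G′ S′ T′ attached-bounded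
          (attached-cases (λ v l h → toAttached (Path-map ++⁺ˡ (isConnected-sound G S T c v l h))) (new newConnected))
          where
          toAttached : ∀ {v} → Path (oldEdges ++ map edge newEdges) (firstTrue S) v → Path (selected T′ (E G′)) (firstTrue S′) v
          toAttached {v} = subst₂ (λ es r → Path es r v) (sym selected-attach) (sym root)
          new : NewPartConnected → ∀ i → suc i < suc k → at s i ≡ true → Path (selected T′ (E G′)) (firstTrue S′) (i + V G)
          new (inj₁ s-empty)     i l h = ⊥-elim (true≢false (trans (sym h) (isEmpty⇒at≡false s i s-empty)))
          new (inj₂ (x∈S , c′)) i l h =
            toAttached (Path-map ++⁺ˡ (isConnected-sound G S T c x x<V x∈S)
                     ▸▸ Path-map (++⁺ʳ oldEdges) (Path-edge (isConnected-sound H (true ∷ s) t c′ (suc i) l h)))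

      module _ (S-empty : isEmpty S ≡ true) (no-old : oldEdges ≡ []) where

        root₀ : firstTrue S′ ≡ firstTrue s + V G
        root₀ = trans (firstTrue-++ʳ S s S-empty) (trans (cong (_+ firstTrue s) |S|) (+-comm (V G) (firstTrue s)))

        selected-attach₀ : selected T′ (E G′) ≡ map edge newEdges
        selected-attach₀ = trans selected-attach (cong (_++ map edge newEdges) no-old)

        connected-attach₀ : isConnected G′ S′ T′ ≡ isConnected H (false ∷ s) t
        connected-attach₀ = bool-ext fw bw
          where
          fw : isConnected G′ S′ T′ ≡ true → isConnected H (false ∷ s) t ≡ true
          fw c = isConnected-complete H (false ∷ s) t newEdges-bounded hPaths
            where
            hPaths : Connects (suc k) newEdges (false ∷ s)
            hPaths (suc i) (s≤s l) h =
              unlift (Path-edge⁻ newEdges (subst₂ (λ es r → Path es r (i + V G)) selected-attach₀ root₀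
                       (isConnected-sound G′ S′ T′ c (i + V G) (vertex-< (suc i) (s≤s l)) (trans (at-new i) h))))
              where
              unlift : ∃[ b ] vertex b ≡ i + V G × Path newEdges (suc (firstTrue s)) b → Path newEdges (suc (firstTrue s)) (suc i)
              unlift (b , e , p) = subst (Path newEdges (suc (firstTrue s))) (vertex-injective b (suc i) e) p
          bw : isConnected H (false ∷ s) t ≡ true → isConnected G′ S′ T′ ≡ true
          bw c = isConnected-complete G′ S′ T′ attached-bounded (attached-cases old new)
            where
            old : ∀ v → v < V G → at S v ≡ true → Path (selected T′ (E G′)) (firstTrue S′) v
            old v _ h = ⊥-elim (true≢false (trans (sym h) (isEmpty⇒at≡false S v S-empty)))
            new : ∀ i → suc i < suc k → at s i ≡ true → Path (selected T′ (E G′)) (firstTrue S′) (i + V G)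
            new i l h = subst₂ (λ es r → Path es r (i + V G)) (sym selected-attach₀) (sym root₀)
                          (Path-edge (isConnected-sound H (false ∷ s) t c (suc i) l h))

      countTrue-S′ : countTrue S′ ≡ countTrue S + countTrue s
      countTrue-S′ = countTrue-++ S s

      countTrue-T′ : countTrue T′ ≡ countTrue T + countTrue t
      countTrue-T′ = countTrue-++ T t

      subgraph-split : isSubgraph G′ S′ T′ ≡ true → isSubgraph G S T ≡ true × isSubgraph H (at S x ∷ s) t ≡ true
      subgraph-split h = ∧-true⁻ (isSubgraph G S T) (trans (sym isSubgraph-attach) h)

      subgraph-join : isSubgraph G S T ≡ true → isSubgraph H (at S x ∷ s) t ≡ true → isSubgraph G′ S′ T′ ≡ true
      subgraph-join sub subH = trans isSubgraph-attach (∧-true sub subH)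

      nonEmpty-transfer : ∀ {m n} → m ≡ n → (m ≡ᵇ 0) ≡ false → (n ≡ᵇ 0) ≡ false
      nonEmpty-transfer refl h = h

      -- Every subtree of G′ is of exactly one of these kinds; the condition on s
      -- keeps the subtrees of G through x out of joinedTree.
      oldTree newTree joinedTree : Bool
      oldTree    = isSubtree G S T ∧ (isEmpty s ∧ isEmpty t)
      newTree    = isEmpty S ∧ (isEmpty T ∧ isSubtree H (false ∷ s) t)
      joinedTree = (isSubtree G S T ∧ at S x) ∧ (isSubtree H (true ∷ s) t ∧ not (isEmpty s))

      module _ (S-empty : isEmpty S ≡ true) where

        x∉S : at S x ≡ false
        x∉S = isEmpty⇒at≡false S x S-empty

        |S′|≡|s| : countTrue S′ ≡ countTrue s
        |S′|≡|s| = trans countTrue-S′ (cong (_+ countTrue s) (isEmpty⇒countTrue≡0 S S-empty))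

        no-oldEdges : isSubgraph G S T ≡ true → oldEdges ≡ []
        no-oldEdges = go oldEdges
          where
          go : ∀ es → all (λ e → at S (proj₁ e) ∧ at S (proj₂ e)) es ≡ true → es ≡ []
          go []             h = refl
          go ((p , q) ∷ es) h rewrite isEmpty⇒at≡false S p S-empty = ⊥-elim (true≢false (sym h))

        isSubtree-new : isSubtree G′ S′ T′ ≡ newTree
        isSubtree-new = bool-ext fw bw
          where
          fw : isSubtree G′ S′ T′ ≡ true → newTree ≡ true
          fw h = ∧-true S-empty (∧-true T-empty (isSubtree-complete H (false ∷ s) t hTree))
            where
            open ≡-Reasoning
            tree′ = isSubtree-sound G′ S′ T′ h
            parts = subgraph-split (IsTree.subgraph tree′)
            T-empty = selected≡[]⇒isEmpty T (E G) |T| (no-oldEdges (proj₁ parts))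
            hTree : IsTree H (false ∷ s) t
            hTree = record
              { subgraph  = subst (λ b → isSubgraph H (b ∷ s) t ≡ true) x∉S (proj₂ parts)
              ; nonEmpty  = nonEmpty-transfer |S′|≡|s| (IsTree.nonEmpty tree′)
              ; connected = trans (sym (connected-attach₀ S-empty (no-oldEdges (proj₁ parts)))) (IsTree.connected tree′)
              ; edges     = begin
                  suc (countTrue t)                   ≡⟨ cong (λ n → suc (n + countTrue t)) (sym (isEmpty⇒countTrue≡0 T T-empty)) ⟩
                  suc (countTrue T + countTrue t)     ≡⟨ cong suc (sym countTrue-T′) ⟩
                  suc (countTrue T′)                  ≡⟨ IsTree.edges tree′ ⟩
                  countTrue S′                        ≡⟨ |S′|≡|s| ⟩
                  countTrue s                         ∎
              }
          bw : newTree ≡ true → isSubtree G′ S′ T′ ≡ true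
          bw h = isSubtree-complete G′ S′ T′ record
            { subgraph  = subgraph-join sub (subst (λ b → isSubgraph H (b ∷ s) t ≡ true) (sym x∉S) (IsTree.subgraph hTree))
            ; nonEmpty  = nonEmpty-transfer (sym |S′|≡|s|) (IsTree.nonEmpty hTree)
            ; connected = trans (connected-attach₀ S-empty no-old) (IsTree.connected hTree)
            ; edges     = begin
                suc (countTrue T′)                    ≡⟨ cong suc countTrue-T′ ⟩
                suc (countTrue T + countTrue t)       ≡⟨ cong (λ n → suc (n + countTrue t)) (isEmpty⇒countTrue≡0 T T-empty) ⟩
                suc (countTrue t)                     ≡⟨ IsTree.edges hTree ⟩
                countTrue s                           ≡⟨ sym |S′|≡|s| ⟩
                countTrue S′                          ∎
            }
            where
            open ≡-Reasoning
            rest = ∧-true⁻ (isEmpty T) (proj₂ (∧-true⁻ (isEmpty S) h))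
            T-empty : isEmpty T ≡ true
            T-empty = proj₁ rest
            hTree : IsTree H (false ∷ s) t
            hTree = isSubtree-sound H (false ∷ s) t (proj₂ rest)
            no-old  = selected-isEmpty T (E G) T-empty
            sub : isSubgraph G S T ≡ true
            sub = subst (λ es → all (λ e → at S (proj₁ e) ∧ at S (proj₂ e)) es ≡ true) (sym no-old) refl

      module _ (S-nonEmpty : isEmpty S ≡ false) where

        isSubtree-old : isEmpty s ≡ true → isSubtree G′ S′ T′ ≡ oldTree
        isSubtree-old s-empty = bool-ext fw bw
          where
          |S′|≡|S| : countTrue S′ ≡ countTrue S
          |S′|≡|S| = trans countTrue-S′ (trans (cong (countTrue S +_) (isEmpty⇒countTrue≡0 s s-empty)) (+-identityʳ _))
          |T′|≡|T| : isEmpty t ≡ true → countTrue T′ ≡ countTrue T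
          |T′|≡|T| t-empty = trans countTrue-T′ (trans (cong (countTrue T +_) (isEmpty⇒countTrue≡0 t t-empty)) (+-identityʳ _))
          fw : isSubtree G′ S′ T′ ≡ true → oldTree ≡ true
          fw h = ∧-true (isSubtree-complete G S T tree) (∧-true s-empty t-empty)
            where
            tree′ = isSubtree-sound G′ S′ T′ h
            parts = subgraph-split (IsTree.subgraph tree′)
            t-empty = root-isolated (at S x) s t |t| s-empty (proj₂ parts)
            tree : IsTree G S T
            tree = record
              { subgraph  = proj₁ parts
              ; nonEmpty  = S-nonEmpty
              ; connected = proj₁ (connected-attach⁻ S-nonEmpty (IsTree.connected tree′) (proj₁ parts))
              ; edges     = trans (cong suc (sym (|T′|≡|T| t-empty))) (trans (IsTree.edges tree′) |S′|≡|S|)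
              }
          bw : oldTree ≡ true → isSubtree G′ S′ T′ ≡ true
          bw h = isSubtree-complete G′ S′ T′ record
            { subgraph  = subgraph-join (IsTree.subgraph tree) newEdges-empty
            ; nonEmpty  = nonEmpty-transfer (sym |S′|≡|S|) S-nonEmpty
            ; connected = connected-attach⁺ S-nonEmpty (IsTree.connected tree) (inj₁ s-empty)
            ; edges     = trans (cong suc (|T′|≡|T| t-empty)) (trans (IsTree.edges tree) (sym |S′|≡|S|))
            }
            where
            parts = ∧-true⁻ (isSubtree G S T) h
            tree : IsTree G S T
            tree = isSubtree-sound G S T (proj₁ parts)
            t-empty : isEmpty t ≡ true
            t-empty = proj₂ (∧-true⁻ (isEmpty s) (proj₂ parts))
            newEdges-empty : isSubgraph H (at S x ∷ s) t ≡ true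
            newEdges-empty = subst (λ es → all (λ e → at (at S x ∷ s) (proj₁ e) ∧ at (at S x ∷ s) (proj₂ e)) es ≡ true)
                              (sym (selected-isEmpty t (hs) t-empty)) refl

        module _ (edgeBound : EdgeBound G) where

          isSubtree-joined : isEmpty s ≡ false → isSubtree G′ S′ T′ ≡ joinedTree
          isSubtree-joined s-nonEmpty = bool-ext fw bw
            where
            fw : isSubtree G′ S′ T′ ≡ true → joinedTree ≡ true
            fw h = join (connected-attach⁻ S-nonEmpty (IsTree.connected tree′) (proj₁ parts))
              where
              tree′ = isSubtree-sound G′ S′ T′ h
              parts = subgraph-split (IsTree.subgraph tree′)
              join : isConnected G S T ≡ true × NewPartConnected → joinedTree ≡ true
              join (_ , inj₁ s-empty) = ⊥-elim (true≢false (trans (sym s-empty) s-nonEmpty))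
              join (connected , inj₂ (x∈S , newConnected)) =
                ∧-true (∧-true (isSubtree-complete G S T tree) x∈S)
                       (∧-true (isSubtree-complete H (true ∷ s) t hTree) (cong not s-nonEmpty))
                where
                hSub : isSubgraph H (true ∷ s) t ≡ true
                hSub = subst (λ b → isSubgraph H (b ∷ s) t ≡ true) x∈S (proj₂ parts)
                -- the edge bounds on both parts force both counts to be tight
                tight : suc (countTrue T) ≡ countTrue S × countTrue t ≡ countTrue s
                tight = tight-sum (edgeBound S T |S| |T| (proj₁ parts) connected)
                                  (≤-pred (H-edgeBound (true ∷ s) t (cong suc |s|) |t| hSub newConnected))
                                  (trans (cong suc (sym countTrue-T′)) (trans (IsTree.edges tree′) countTrue-S′))
                tree : IsTree G S T
                tree = record { subgraph = proj₁ parts ; nonEmpty = S-nonEmpty ; connected = connected ; edges = proj₁ tight }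
                hTree : IsTree H (true ∷ s) t
                hTree = record { subgraph = hSub ; nonEmpty = refl ; connected = newConnected ; edges = cong suc (proj₂ tight) }
            bw : joinedTree ≡ true → isSubtree G′ S′ T′ ≡ true
            bw h = isSubtree-complete G′ S′ T′ record
              { subgraph  = subgraph-join (IsTree.subgraph tree)
                              (subst (λ b → isSubgraph H (b ∷ s) t ≡ true) (sym x∈S) (IsTree.subgraph hTree))
              ; nonEmpty  = nonEmpty-transfer (sym countTrue-S′) (nonEmpty-+ (countTrue S) (countTrue s) (IsTree.nonEmpty tree))
              ; connected = connected-attach⁺ S-nonEmpty (IsTree.connected tree) (inj₂ (x∈S , IsTree.connected hTree))
              ; edges     = begin
                  suc (countTrue T′)              ≡⟨ cong suc countTrue-T′ ⟩
                  suc (countTrue T) + countTrue t ≡⟨ cong₂ _+_ (IsTree.edges tree) (suc-injective (IsTree.edges hTree)) ⟩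
                  countTrue S + countTrue s       ≡⟨ sym countTrue-S′ ⟩
                  countTrue S′                    ∎
              }
              where
              open ≡-Reasoning
              parts = ∧-true⁻ (isSubtree G S T ∧ at S x) h
              old = ∧-true⁻ (isSubtree G S T) (proj₁ parts)
              x∈S : at S x ≡ true
              x∈S = proj₂ old
              tree : IsTree G S T
              tree = isSubtree-sound G S T (proj₁ old)
              hTree : IsTree H (true ∷ s) t
              hTree = isSubtree-sound H (true ∷ s) t (proj₁ (∧-true⁻ (isSubtree H (true ∷ s) t) (proj₂ parts)))
              nonEmpty-+ : ∀ a b → (a ≡ᵇ 0) ≡ false → ((a + b) ≡ᵇ 0) ≡ false
              nonEmpty-+ (suc a) b _ = refl

      𝟙-isSubtree-attach : EdgeBound G → 𝟙 (isSubtree G′ S′ T′) ≡ 𝟙 oldTree + 𝟙 newTree + 𝟙 joinedTree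
      𝟙-isSubtree-attach edgeBound = byEmptiness (isEmpty S) refl (isEmpty s) refl
        where
        byEmptiness : ∀ b → isEmpty S ≡ b → ∀ b′ → isEmpty s ≡ b′ →
                      𝟙 (isSubtree G′ S′ T′) ≡ 𝟙 oldTree + 𝟙 newTree + 𝟙 joinedTree
        byEmptiness true S-empty _ _ =
          trans (cong 𝟙 (isSubtree-new S-empty))
                (𝟙-only₂ (cong (_∧ (isEmpty s ∧ isEmpty t)) (isSubtree-empty G S T S-empty))
                         (cong (λ b → (b ∧ at S x) ∧ (isSubtree H (true ∷ s) t ∧ not (isEmpty s))) (isSubtree-empty G S T S-empty)))
        byEmptiness false S-nonEmpty true s-empty =
          trans (cong 𝟙 (isSubtree-old S-nonEmpty s-empty))
                (𝟙-only₁ (cong (_∧ (isEmpty T ∧ isSubtree H (false ∷ s) t)) S-nonEmpty)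
                         (trans (cong (λ b → (isSubtree G S T ∧ at S x) ∧ (isSubtree H (true ∷ s) t ∧ not b)) s-empty)
                                (trans (cong ((isSubtree G S T ∧ at S x) ∧_) (∧-zeroʳ (isSubtree H (true ∷ s) t)))
                                       (∧-zeroʳ (isSubtree G S T ∧ at S x)))))
        byEmptiness false S-nonEmpty false s-nonEmpty =
          trans (cong 𝟙 (isSubtree-joined S-nonEmpty edgeBound s-nonEmpty))
                (𝟙-only₃ (trans (cong (λ b → isSubtree G S T ∧ (b ∧ isEmpty t)) s-nonEmpty) (∧-zeroʳ (isSubtree G S T)))
                         (cong (_∧ (isEmpty T ∧ isSubtree H (false ∷ s) t)) S-nonEmpty))

      edgeBound-attach : EdgeBound G → isSubgraph G′ S′ T′ ≡ true → isConnected G′ S′ T′ ≡ true →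
                       countTrue S′ ≤ suc (countTrue T′)
      edgeBound-attach edgeBound sub′ conn′ = byEmptiness (isEmpty S) refl
        where
        parts = subgraph-split sub′
        byEmptiness : ∀ b → isEmpty S ≡ b → countTrue S′ ≤ suc (countTrue T′)
        byEmptiness true S-empty = begin
          countTrue S′                    ≡⟨ |S′|≡|s| S-empty ⟩
          countTrue s                     ≤⟨ H-edgeBound (false ∷ s) t (cong suc |s|) |t| hSub newConnected ⟩
          suc (countTrue t)               ≤⟨ s≤s (m≤n+m (countTrue t) (countTrue T)) ⟩
          suc (countTrue T + countTrue t) ≡⟨ cong suc (sym countTrue-T′) ⟩
          suc (countTrue T′)              ∎
          where
          open ≤-Reasoning
          hSub = subst (λ b → isSubgraph H (b ∷ s) t ≡ true) (x∉S S-empty) (proj₂ parts)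
          newConnected = trans (sym (connected-attach₀ S-empty (no-oldEdges S-empty (proj₁ parts)))) conn′
        byEmptiness false S-nonEmpty = begin
          countTrue S′                    ≡⟨ countTrue-S′ ⟩
          countTrue S + countTrue s
            ≤⟨ +-mono-≤ (edgeBound S T |S| |T| (proj₁ parts) (proj₁ connected)) (hBound (proj₂ connected)) ⟩
          suc (countTrue T) + countTrue t ≡⟨ cong suc (sym countTrue-T′) ⟩
          suc (countTrue T′)              ∎
          where
          open ≤-Reasoning
          connected = connected-attach⁻ S-nonEmpty conn′ (proj₁ parts)
          hBound : NewPartConnected → countTrue s ≤ countTrue t
          hBound (inj₁ s-empty) = subst (_≤ countTrue t) (sym (isEmpty⇒countTrue≡0 s s-empty)) z≤n
          hBound (inj₂ (x∈S , c)) = ≤-pred (H-edgeBound (true ∷ s) t (cong suc |s|) |t|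
                                        (subst (λ b → isSubgraph H (b ∷ s) t ≡ true) x∈S (proj₂ parts)) c)

    attach-bounded : Bounded (V G) (E G) → Bounded (V G′) (E G′)
    attach-bounded bounded = All-++⁺ (Bounded-mono (m≤m+n (V G) k) bounded) (Bounded-edge hs-bounded)

    length-attach : length (E G′) ≡ length (E G) + length hs
    length-attach = trans (length-++ (E G)) (cong (length (E G) +_) (length-map edge hs))

    attach-edgeBound : Bounded (V G) (E G) → EdgeBound G → EdgeBound G′
    attach-edgeBound bounded edgeBound S′ T′ |S′| |T′|
      with ++-split (V G) k S′ |S′| | ++-split (length (E G)) (length hs) T′ (trans |T′| length-attach)
    ... | S , s , |S| , |s| , refl | T , t , |T| , |t| , refl = Split.edgeBound-attach bounded S T s t |S| |T| |s| |t| edgeBound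

  -- Counting the subtrees of an attachment

  ∑² : ℕ → ℕ → (List Bool → List Bool → ℕ) → ℕ
  ∑² a b f = ∑ᴹ a (λ S → ∑ᴹ b (f S))

  ∑²-+ : ∀ a b (f g : List Bool → List Bool → ℕ) → ∑² a b (λ S T → f S T + g S T) ≡ ∑² a b f + ∑² a b g
  ∑²-+ a b f g = trans (∑-cong (allMasks a) (λ S → ∑-+ (allMasks b) (f S) (g S)))
                       (∑-+ (allMasks a) (λ S → ∑ᴹ b (f S)) (λ S → ∑ᴹ b (g S)))

  ∑²-*ˡ : ∀ a b c (f : List Bool → List Bool → ℕ) → ∑² a b (λ S T → c * f S T) ≡ c * ∑² a b f
  ∑²-*ˡ a b c f = trans (∑-cong (allMasks a) (λ S → ∑-*ˡ (allMasks b) c (f S)))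
                        (∑-*ˡ (allMasks a) c (λ S → ∑ᴹ b (f S)))

  ∑²-*ʳ : ∀ a b c (f : List Bool → List Bool → ℕ) → ∑² a b (λ S T → f S T * c) ≡ ∑² a b f * c
  ∑²-*ʳ a b c f = trans (∑-cong (allMasks a) (λ S → ∑-*ʳ (allMasks b) c (f S)))
                        (∑-*ʳ (allMasks a) c (λ S → ∑ᴹ b (f S)))

  ∑²-cong : ∀ a b {f g : List Bool → List Bool → ℕ} → (∀ S T → f S T ≡ g S T) → ∑² a b f ≡ ∑² a b g
  ∑²-cong a b e = ∑-cong (allMasks a) (λ S → ∑-cong (allMasks b) (e S))

  ∑²-linearˡ : ∀ a b (f g h : List Bool → List Bool → ℕ) p q r →
    ∑² a b (λ S T → p * f S T + q * g S T + r * h S T) ≡ p * ∑² a b f + q * ∑² a b g + r * ∑² a b h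
  ∑²-linearˡ a b f g h p q r =
    trans (trans (∑²-+ a b _ _) (cong (_+ ∑² a b (λ S T → r * h S T)) (∑²-+ a b _ _)))
          (cong₂ _+_ (cong₂ _+_ (∑²-*ˡ a b p f) (∑²-*ˡ a b q g)) (∑²-*ˡ a b r h))

  ∑²-linearʳ : ∀ a b (f g h : List Bool → List Bool → ℕ) p q r →
    ∑² a b (λ S T → f S T * p + g S T * q + h S T * r) ≡ ∑² a b f * p + ∑² a b g * q + ∑² a b h * r
  ∑²-linearʳ a b f g h p q r =
    trans (trans (∑²-+ a b _ _) (cong (_+ ∑² a b (λ S T → h S T * r)) (∑²-+ a b _ _)))
          (cong₂ _+_ (cong₂ _+_ (∑²-*ʳ a b p f) (∑²-*ʳ a b q g)) (∑²-*ʳ a b r h))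

  ∑²-isEmpty : ∀ a b → ∑² a b (λ S T → 𝟙 (isEmpty S ∧ isEmpty T)) ≡ 1
  ∑²-isEmpty a b = begin
    ∑² a b (λ S T → 𝟙 (isEmpty S ∧ isEmpty T))       ≡⟨ ∑²-cong a b (λ S T → 𝟙-∧ (isEmpty S) (isEmpty T)) ⟩
    ∑ᴹ a (λ S → ∑ᴹ b (λ T → 𝟙 (isEmpty S) * 𝟙 (isEmpty T)))
      ≡⟨ ∑-cong (allMasks a) (λ S → trans (∑-*ˡ (allMasks b) (𝟙 (isEmpty S)) (𝟙 ∘ isEmpty))
                                          (trans (cong (𝟙 (isEmpty S) *_) (∑ᴹ-isEmpty b)) (*-identityʳ _))) ⟩
    ∑ᴹ a (𝟙 ∘ isEmpty)                               ≡⟨ ∑ᴹ-isEmpty a ⟩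
    1                                                ∎
    where open ≡-Reasoning

  ∑subtrees : Graph → (List Bool → ℕ) → ℕ
  ∑subtrees G w = ∑² (V G) (length (E G)) (λ S T → 𝟙 (isSubtree G S T) * w S)

  STN≡∑subtrees : ∀ G → STN G ≡ ∑subtrees G (λ _ → 1)
  STN≡∑subtrees G = begin
    STN G
      ≡⟨ length-filter-𝟙 (allPairs G) (λ p → isSubtree G (proj₁ p) (proj₂ p)) ⟩
    ∑ (allPairs G) (λ p → 𝟙 (isSubtree G (proj₁ p) (proj₂ p)))
      ≡⟨ ∑-concatMap _ (allMasks (V G)) _ ⟩
    ∑ᴹ (V G) (λ S → ∑ (map (S ,_) (allMasks (length (E G)))) (λ p → 𝟙 (isSubtree G (proj₁ p) (proj₂ p))))
      ≡⟨ ∑-cong (allMasks (V G)) (λ S → trans (∑-map (S ,_) (allMasks (length (E G))) _)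
                                              (∑-cong (allMasks (length (E G))) (λ T → sym (*-identityʳ _)))) ⟩
    ∑subtrees G (λ _ → 1) ∎
    where open ≡-Reasoning

  STNat : Graph → ℕ → ℕ
  STNat G x = ∑subtrees G (λ S → 𝟙 (at S x))

  rootOnly rootAvoiding rootExtending : ℕ → List Edge → (List Bool → ℕ) → ℕ
  rootOnly      k hs w = ∑² k (length hs) (λ s t → 𝟙 (isEmpty s ∧ isEmpty t) * w s)
  rootAvoiding  k hs w = ∑² k (length hs) (λ s t → 𝟙 (isSubtree (graph (suc k) hs) (false ∷ s) t) * w s)
  rootExtending k hs w = ∑² k (length hs) (λ s t → 𝟙 (isSubtree (graph (suc k) hs) (true ∷ s) t ∧ not (isEmpty s)) * w s)

  module AttachingCount (G : Graph) (x : ℕ) (x<V : x < V G) (k : ℕ) (hs : List Edge) (hs-bounded : Bounded (suc k) hs)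
                        (hs-loopless : Loopless hs) (H-edgeBound : EdgeBound (graph (suc k) hs))
                        (bounded : Bounded (V G) (E G)) (edgeBound : EdgeBound G)
                        (W w : List Bool → ℕ) (W≡w : ∀ S s → length S ≡ V G → W (S ++ s) ≡ w s) where

    open Attaching G x x<V k hs hs-bounded hs-loopless H-edgeBound

    private
      |E| |hs| : ℕ
      |E| = length (E G)
      |hs| = length hs

      ∑subtrees-split : ∑subtrees G′ W ≡
        ∑² (V G) |E| (λ S T → ∑² k |hs| (λ s t → 𝟙 (isSubtree G′ (S ++ s) (T ++ t)) * w s))
      ∑subtrees-split = begin
        ∑subtrees G′ W
          ≡⟨ ∑-cong (allMasks (V G + k)) (λ S′ → cong (λ n → ∑ᴹ n (λ T′ → 𝟙 (isSubtree G′ S′ T′) * W S′)) length-attach) ⟩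
        ∑² (V G + k) (|E| + |hs|) (λ S′ T′ → 𝟙 (isSubtree G′ S′ T′) * W S′)
          ≡⟨ ∑ᴹ-++ (V G) k _ ⟩
        ∑ᴹ (V G) (λ S → ∑ᴹ k (λ s → ∑ᴹ (|E| + |hs|) (λ T′ → 𝟙 (isSubtree G′ (S ++ s) T′) * W (S ++ s))))
          ≡⟨ ∑-cong (allMasks (V G)) (λ S → ∑-cong (allMasks k) (λ s → ∑ᴹ-++ |E| |hs| _)) ⟩
        ∑ᴹ (V G) (λ S → ∑ᴹ k (λ s → ∑² |E| |hs| (λ T t → 𝟙 (isSubtree G′ (S ++ s) (T ++ t)) * W (S ++ s))))
          ≡⟨ ∑ᴹ-cong (V G) (λ S |S| → ∑-cong (allMasks k) (λ s →
               ∑²-cong |E| |hs| (λ T t → cong (𝟙 (isSubtree G′ (S ++ s) (T ++ t)) *_) (W≡w S s |S|)))) ⟩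
        ∑ᴹ (V G) (λ S → ∑ᴹ k (λ s → ∑² |E| |hs| (λ T t → 𝟙 (isSubtree G′ (S ++ s) (T ++ t)) * w s)))
          ≡⟨ ∑-cong (allMasks (V G)) (λ S → ∑-comm (allMasks k) (allMasks |E|) _) ⟩
        ∑² (V G) |E| (λ S T → ∑² k |hs| (λ s t → 𝟙 (isSubtree G′ (S ++ s) (T ++ t)) * w s)) ∎
        where open ≡-Reasoning

      oldCount newCount joinedCount : List Bool → List Bool → ℕ
      oldCount    S T = 𝟙 (isSubtree G S T)
      newCount    S T = 𝟙 (isEmpty S ∧ isEmpty T)
      joinedCount S T = 𝟙 (isSubtree G S T ∧ at S x)

      rootOnlyCount : List Bool → List Bool → ℕ
      rootOnlyCount s t = 𝟙 (isEmpty s ∧ isEmpty t) * w s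

      weighted-split : ∀ S T s t → length S ≡ V G → length T ≡ |E| → length s ≡ k → length t ≡ |hs| →
        𝟙 (isSubtree G′ (S ++ s) (T ++ t)) * w s
          ≡ oldCount S T * rootOnlyCount s t
            + newCount S T * (𝟙 (isSubtree H (false ∷ s) t) * w s)
            + joinedCount S T * (𝟙 (isSubtree H (true ∷ s) t ∧ not (isEmpty s)) * w s)
      weighted-split S T s t |S| |T| |s| |t| = begin
        𝟙 (isSubtree G′ (S ++ s) (T ++ t)) * w s
          ≡⟨ cong (_* w s) (Split.𝟙-isSubtree-attach bounded S T s t |S| |T| |s| |t| edgeBound) ⟩
        (𝟙 (isSubtree G S T ∧ (isEmpty s ∧ isEmpty t)) + 𝟙 (isEmpty S ∧ (isEmpty T ∧ hAvoiding))
          + 𝟙 ((isSubtree G S T ∧ at S x) ∧ hExtending)) * w s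
          ≡⟨ cong (_* w s) (cong₂ _+_ (cong₂ _+_ (𝟙-∧ (isSubtree G S T) _) (𝟙-∧∧ (isEmpty S) (isEmpty T) hAvoiding))
                                      (𝟙-∧ (isSubtree G S T ∧ at S x) hExtending)) ⟩
        (oldCount S T * 𝟙 (isEmpty s ∧ isEmpty t) + newCount S T * 𝟙 hAvoiding + joinedCount S T * 𝟙 hExtending) * w s
          ≡⟨ distribute (oldCount S T) (newCount S T) (joinedCount S T) _ _ _ (w s) ⟩
        oldCount S T * rootOnlyCount s t + newCount S T * (𝟙 hAvoiding * w s) + joinedCount S T * (𝟙 hExtending * w s) ∎
        where
        open ≡-Reasoning
        hAvoiding hExtending : Bool
        hAvoiding  = isSubtree H (false ∷ s) t
        hExtending = isSubtree H (true ∷ s) t ∧ not (isEmpty s)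
        𝟙-∧∧ : ∀ a b c → 𝟙 (a ∧ (b ∧ c)) ≡ 𝟙 (a ∧ b) * 𝟙 c
        𝟙-∧∧ true  true  c = sym (+-identityʳ (𝟙 c))
        𝟙-∧∧ true  false c = refl
        𝟙-∧∧ false b     c = refl
        distribute : ∀ a b c d e f w → (a * d + b * e + c * f) * w ≡ a * (d * w) + b * (e * w) + c * (f * w)
        distribute = solve 7 (λ a b c d e f w → (a :* d :+ b :* e :+ c :* f) :* w
                                               := a :* (d :* w) :+ b :* (e :* w) :+ c :* (f :* w)) refl
          where open +-*-Solver

    ∑subtrees-attach : ∑subtrees G′ W ≡
      ∑subtrees G (λ _ → 1) * rootOnly k hs w + rootAvoiding k hs w + STNat G x * rootExtending k hs w
    ∑subtrees-attach = begin
      ∑subtrees G′ W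
        ≡⟨ ∑subtrees-split ⟩
      ∑² (V G) |E| (λ S T → ∑² k |hs| (λ s t → 𝟙 (isSubtree G′ (S ++ s) (T ++ t)) * w s))
        ≡⟨ ∑ᴹ-cong (V G) (λ S |S| → ∑ᴹ-cong |E| (λ T |T| → ∑ᴹ-cong k (λ s |s| → ∑ᴹ-cong |hs| (λ t |t| →
             weighted-split S T s t |S| |T| |s| |t|)))) ⟩
      ∑² (V G) |E| (λ S T → ∑² k |hs| (λ s t → oldCount S T * rootOnlyCount s t + newCount S T * Y s t
                                                + joinedCount S T * Z s t))
        ≡⟨ ∑²-cong (V G) |E| (λ S T → ∑²-linearˡ k |hs| rootOnlyCount Y Z (oldCount S T) (newCount S T) (joinedCount S T)) ⟩
      ∑² (V G) |E| (λ S T → oldCount S T * rootOnly k hs w + newCount S T * rootAvoiding k hs w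
                            + joinedCount S T * rootExtending k hs w)
        ≡⟨ ∑²-linearʳ (V G) |E| oldCount newCount joinedCount (rootOnly k hs w) (rootAvoiding k hs w) (rootExtending k hs w) ⟩
      ∑² (V G) |E| oldCount * rootOnly k hs w + ∑² (V G) |E| newCount * rootAvoiding k hs w
        + ∑² (V G) |E| joinedCount * rootExtending k hs w
        ≡⟨ cong₂ _+_ (cong₂ _+_ (cong (_* rootOnly k hs w) ∑-oldCount)
                                (trans (cong (_* rootAvoiding k hs w) (∑²-isEmpty (V G) |E|)) (+-identityʳ _)))
                     (cong (_* rootExtending k hs w) ∑-joinedCount) ⟩
      ∑subtrees G (λ _ → 1) * rootOnly k hs w + rootAvoiding k hs w + STNat G x * rootExtending k hs w ∎
      where
      open ≡-Reasoning
      Y Z : List Bool → List Bool → ℕ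
      Y s t = 𝟙 (isSubtree H (false ∷ s) t) * w s
      Z s t = 𝟙 (isSubtree H (true ∷ s) t ∧ not (isEmpty s)) * w s
      ∑-oldCount : ∑² (V G) |E| oldCount ≡ ∑subtrees G (λ _ → 1)
      ∑-oldCount = ∑²-cong (V G) |E| (λ S T → sym (*-identityʳ _))
      ∑-joinedCount : ∑² (V G) |E| joinedCount ≡ STNat G x
      ∑-joinedCount = ∑²-cong (V G) |E| (λ S T → 𝟙-∧ (isSubtree G S T) (at S x))

  hexagon : List Edge
  hexagon = hexEdges 0 1

  Hex : Graph
  Hex = graph 6 hexagon

  glue : Graph → ℕ → Graph
  glue G x = attach G x 5 hexagon

  Hex-bounded : Bounded 6 hexagon
  Hex-bounded = (<ᵇ⇒< 0 6 _ , <ᵇ⇒< 1 6 _) ∷ (<ᵇ⇒< 1 6 _ , <ᵇ⇒< 2 6 _) ∷ (<ᵇ⇒< 2 6 _ , <ᵇ⇒< 3 6 _)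
              ∷ (<ᵇ⇒< 3 6 _ , <ᵇ⇒< 4 6 _) ∷ (<ᵇ⇒< 4 6 _ , <ᵇ⇒< 5 6 _) ∷ (<ᵇ⇒< 5 6 _ , <ᵇ⇒< 0 6 _) ∷ []

  Hex-loopless : Loopless hexagon
  Hex-loopless = (λ ()) ∷ (λ ()) ∷ (λ ()) ∷ (λ ()) ∷ (λ ()) ∷ (λ ()) ∷ []

  Hex-edgeBound : EdgeBound Hex
  Hex-edgeBound S T |S| |T| sub conn = ≤ᵇ-sound (countTrue S) (suc (countTrue T)) bound
    where
    boundTest : List Bool → List Bool → Bool
    boundTest S T = not (isSubgraph Hex S T ∧ isConnected Hex S T) ∨ (countTrue S ≤ᵇ suc (countTrue T))
    checked : all (λ S → all (boundTest S) (allMasks 6)) (allMasks 6) ≡ true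
    checked = refl
    bound : (countTrue S ≤ᵇ suc (countTrue T)) ≡ true
    bound = ⇒-true (isSubgraph Hex S T) (isConnected Hex S T) _
              (allMasks-sound 6 (boundTest S) (allMasks-sound 6 (λ S → all (boundTest S) (allMasks 6)) checked S |S|) T |T|)
              sub conn

  rootOnly-Hex : rootOnly 5 hexagon (λ _ → 1) ≡ 1
  rootOnly-Hex = refl

  rootAvoiding-Hex : rootAvoiding 5 hexagon (λ _ → 1) ≡ 15
  rootAvoiding-Hex = refl

  rootExtending-Hex : rootExtending 5 hexagon (λ _ → 1) ≡ 20
  rootExtending-Hex = refl

  -- subtrees of the hexagon through its vertex toℕ d + 1, not containing resp.
  -- containing the vertex 0
  throughAvoiding throughContaining : Fin 3 → ℕ
  throughAvoiding Fin.zero                     = 5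
  throughAvoiding (Fin.suc Fin.zero)           = 8
  throughAvoiding (Fin.suc (Fin.suc Fin.zero)) = 9
  throughContaining Fin.zero                     = 16
  throughContaining (Fin.suc Fin.zero)           = 13
  throughContaining (Fin.suc (Fin.suc Fin.zero)) = 12

  through : Fin 3 → List Bool → ℕ
  through d s = 𝟙 (at s (toℕ d))

  rootOnly-through : ∀ d → rootOnly 5 hexagon (through d) ≡ 0
  rootOnly-through Fin.zero                   = refl
  rootOnly-through (Fin.suc Fin.zero)         = refl
  rootOnly-through (Fin.suc (Fin.suc Fin.zero)) = refl

  rootAvoiding-through : ∀ d → rootAvoiding 5 hexagon (through d) ≡ throughAvoiding d
  rootAvoiding-through Fin.zero                   = refl
  rootAvoiding-through (Fin.suc Fin.zero)         = refl
  rootAvoiding-through (Fin.suc (Fin.suc Fin.zero)) = refl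

  rootExtending-through : ∀ d → rootExtending 5 hexagon (through d) ≡ throughContaining d
  rootExtending-through Fin.zero                   = refl
  rootExtending-through (Fin.suc Fin.zero)         = refl
  rootExtending-through (Fin.suc (Fin.suc Fin.zero)) = refl

  record Admissible (G : Graph) : Set where
    field
      bounded   : Bounded (V G) (E G)
      edgeBound : EdgeBound G

  Hex-admissible : Admissible Hex
  Hex-admissible = record { bounded = Hex-bounded ; edgeBound = Hex-edgeBound }

  module Glue (G : Graph) (x : ℕ) (x<V : x < V G) (admissible : Admissible G) where

    open Admissible admissible
    open Attaching G x x<V 5 hexagon Hex-bounded Hex-loopless Hex-edgeBound using (attach-bounded; attach-edgeBound)
    open AttachingCount G x x<V 5 hexagon Hex-bounded Hex-loopless Hex-edgeBound bounded edgeBound using (∑subtrees-attach)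

    glue-admissible : Admissible (glue G x)
    glue-admissible = record { bounded = attach-bounded bounded ; edgeBound = attach-edgeBound bounded edgeBound }

    STN-glue : STN (glue G x) ≡ STN G + 15 + 20 * STNat G x
    STN-glue = begin
      STN (glue G x)                                     ≡⟨ STN≡∑subtrees (glue G x) ⟩
      ∑subtrees (glue G x) (λ _ → 1)
        ≡⟨ ∑subtrees-attach (λ _ → 1) (λ _ → 1) (λ _ _ _ → refl) ⟩
      ∑subtrees G (λ _ → 1) * rootOnly 5 hexagon (λ _ → 1) + rootAvoiding 5 hexagon (λ _ → 1)
        + STNat G x * rootExtending 5 hexagon (λ _ → 1)
        ≡⟨ cong₂ _+_ (cong₂ _+_ (cong (∑subtrees G (λ _ → 1) *_) rootOnly-Hex) rootAvoiding-Hex)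
                     (cong (STNat G x *_) rootExtending-Hex) ⟩
      ∑subtrees G (λ _ → 1) * 1 + 15 + STNat G x * 20
        ≡⟨ cong₂ _+_ (cong (_+ 15) (trans (*-identityʳ _) (sym (STN≡∑subtrees G)))) (*-comm (STNat G x) 20) ⟩
      STN G + 15 + 20 * STNat G x ∎
      where open ≡-Reasoning

    STNat-glue : ∀ d → STNat (glue G x) (toℕ d + V G) ≡ throughAvoiding d + throughContaining d * STNat G x
    STNat-glue d = begin
      STNat (glue G x) (toℕ d + V G)
        ≡⟨ ∑subtrees-attach (λ S′ → 𝟙 (at S′ (toℕ d + V G))) (through d)
             (λ S s |S| → cong 𝟙 (subst (λ n → at (S ++ s) (toℕ d + n) ≡ at s (toℕ d)) |S| (at-++ʳ S s (toℕ d)))) ⟩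
      ∑subtrees G (λ _ → 1) * rootOnly 5 hexagon (through d) + rootAvoiding 5 hexagon (through d)
        + STNat G x * rootExtending 5 hexagon (through d)
        ≡⟨ cong₂ _+_ (cong₂ _+_ (cong (∑subtrees G (λ _ → 1) *_) (rootOnly-through d)) (rootAvoiding-through d))
                     (cong (STNat G x *_) (rootExtending-through d)) ⟩
      ∑subtrees G (λ _ → 1) * 0 + throughAvoiding d + STNat G x * throughContaining d
        ≡⟨ cong₂ _+_ (cong (_+ throughAvoiding d) (*-zeroʳ (∑subtrees G (λ _ → 1)))) (*-comm (STNat G x) (throughContaining d)) ⟩
      throughAvoiding d + throughContaining d * STNat G x ∎
      where open ≡-Reasoning

  -- Spiro chains as iterated gluings

  chain : (k : ℕ) → Vec (Fin 3) k → Graph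
  chain k ds = spiro (2 + k) ds

  -- the first fresh label of the last hexagon of tailEdges e b ds
  lastStart : ℕ → List (Fin 3) → ℕ
  lastStart b []       = b
  lastStart b (_ ∷ ds) = lastStart (5 + b) ds

  lastStart-length : ∀ b ds → lastStart b ds ≡ 5 * length ds + b
  lastStart-length b []       = refl
  lastStart-length b (d ∷ ds) = trans (lastStart-length (5 + b) ds) (+-suc-5 (length ds) b)
    where
    +-suc-5 : ∀ n b → 5 * n + (5 + b) ≡ 5 * suc n + b
    +-suc-5 = solve 2 (λ n b → con 5 :* n :+ (con 5 :+ b) := con 5 :* (con 1 :+ n) :+ b) refl
      where open +-*-Solver

  lastStart-snoc : ∀ b ds d → lastStart b (ds ++ d ∷ []) ≡ 5 + lastStart b ds
  lastStart-snoc b []        d = refl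
  lastStart-snoc b (d′ ∷ ds) d = lastStart-snoc (5 + b) ds d

  tailEdges-snoc : ∀ e b ds d →
    tailEdges e b (ds ++ d ∷ []) ≡ tailEdges e b ds ++ hexEdges (lastStart b ds + toℕ d) (5 + lastStart b ds)
  tailEdges-snoc e b []        d = refl
  tailEdges-snoc e b (d′ ∷ ds) d = trans (cong (hexEdges e b ++_) (tailEdges-snoc (b + toℕ d′) (5 + b) ds d))
                                         (sym (++-assoc (hexEdges e b) (tailEdges (b + toℕ d′) (5 + b) ds) _))

  -- the vertex of the last hexagon of chain k ds at distance toℕ d + 1 from its entry
  exit : ∀ {k} → Vec (Fin 3) k → Fin 3 → ℕ
  exit ds d = lastStart 6 (toList ds) + toℕ d

  V-chain : ∀ k (ds : Vec (Fin 3) k) → V (chain k ds) ≡ 5 + lastStart 6 (toList ds)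
  V-chain k ds = begin
    1 + 5 * (2 + k)              ≡⟨ 11+5k k ⟩
    5 + (5 * k + 6)              ≡⟨ cong (λ n → 5 + (5 * n + 6)) (sym (length-toList ds)) ⟩
    5 + (5 * length (toList ds) + 6) ≡⟨ cong (5 +_) (sym (lastStart-length 6 (toList ds))) ⟩
    5 + lastStart 6 (toList ds)  ∎
    where
    open ≡-Reasoning
    11+5k : ∀ k → 1 + 5 * (2 + k) ≡ 5 + (5 * k + 6)
    11+5k = solve 1 (λ k → con 1 :+ con 5 :* (con 2 :+ k) := con 5 :+ (con 5 :* k :+ con 6)) refl
      where open +-*-Solver

  exit<V : ∀ k (ds : Vec (Fin 3) k) d → exit ds d < V (chain k ds)
  exit<V k ds d = subst (exit ds d <_) (sym (V-chain k ds))
    (subst (_< 5 + lastStart 6 (toList ds)) (+-comm (toℕ d) (lastStart 6 (toList ds)))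
      (+-monoˡ-< (lastStart 6 (toList ds)) (≤-trans (toℕ<n d) (s≤s (s≤s (s≤s z≤n))))))

  chain-snoc : ∀ k (ds : Vec (Fin 3) k) d → chain (suc k) (ds ∷ʳ d) ≡ glue (chain k ds) (exit ds d)
  chain-snoc k ds d = cong₂ graph (16+5k k) (begin
    hexagon ++ tailEdges 0 6 (toList (ds ∷ʳ d))
      ≡⟨ cong (λ l → hexagon ++ tailEdges 0 6 l) (toList-∷ʳ d ds) ⟩
    hexagon ++ tailEdges 0 6 (toList ds ++ d ∷ [])
      ≡⟨ cong (hexagon ++_) (tailEdges-snoc 0 6 (toList ds) d) ⟩
    hexagon ++ (tailEdges 0 6 (toList ds) ++ hexEdges (exit ds d) (5 + lastStart 6 (toList ds)))
      ≡⟨ cong (λ n → hexagon ++ (tailEdges 0 6 (toList ds) ++ hexEdges (exit ds d) n)) (sym (V-chain k ds)) ⟩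
    hexagon ++ (tailEdges 0 6 (toList ds) ++ hexEdges (exit ds d) (V (chain k ds)))
      ≡⟨ sym (++-assoc hexagon (tailEdges 0 6 (toList ds)) _) ⟩
    E (glue (chain k ds) (exit ds d)) ∎)
    where
    open ≡-Reasoning
    16+5k : ∀ k → 1 + 5 * (3 + k) ≡ (1 + 5 * (2 + k)) + 5
    16+5k = solve 1 (λ k → con 1 :+ con 5 :* (con 3 :+ k) := (con 1 :+ con 5 :* (con 2 :+ k)) :+ con 5) refl
      where open +-*-Solver

  exit-snoc : ∀ k (ds : Vec (Fin 3) k) d d′ → exit (ds ∷ʳ d) d′ ≡ toℕ d′ + V (chain k ds)
  exit-snoc k ds d d′ = begin
    lastStart 6 (toList (ds ∷ʳ d)) + toℕ d′     ≡⟨ cong (λ l → lastStart 6 l + toℕ d′) (toList-∷ʳ d ds) ⟩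
    lastStart 6 (toList ds ++ d ∷ []) + toℕ d′  ≡⟨ cong (_+ toℕ d′) (lastStart-snoc 6 (toList ds) d) ⟩
    5 + lastStart 6 (toList ds) + toℕ d′        ≡⟨ cong (_+ toℕ d′) (sym (V-chain k ds)) ⟩
    V (chain k ds) + toℕ d′                     ≡⟨ +-comm (V (chain k ds)) (toℕ d′) ⟩
    toℕ d′ + V (chain k ds)                     ∎
    where open ≡-Reasoning

  chain-admissible : ∀ k (ds : Vec (Fin 3) k) → Admissible (chain k ds)
  chain-admissible zero    Vec.[] = Glue.glue-admissible Hex 0 (s≤s z≤n) Hex-admissible
  chain-admissible (suc k) ds with initLast ds
  ... | ds′ , d , refl = subst Admissible (sym (chain-snoc k ds′ d))
                           (Glue.glue-admissible (chain k ds′) (exit ds′ d) (exit<V k ds′ d) (chain-admissible k ds′))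

  Hex-STN : STN Hex ≡ 36
  Hex-STN = refl

  Hex-STNat : STNat Hex 0 ≡ 21
  Hex-STNat = refl

  chain-[] : chain 0 Vec.[] ≡ glue Hex 0
  chain-[] = refl

  -- Opaque, so that conversion checking never unfolds these exponential counts
  -- (for the same reason the endpoints of cong are given explicitly below).
  opaque
    chainSTN : (k : ℕ) → Vec (Fin 3) k → ℕ
    chainSTN k ds = STN (chain k ds)

    exitSTN : (k : ℕ) → Vec (Fin 3) k → Fin 3 → ℕ
    exitSTN k ds d = STNat (chain k ds) (exit ds d)

    chainSTN-def : ∀ k ds → chainSTN k ds ≡ STN (chain k ds)
    chainSTN-def k ds = refl

    exitSTN-def : ∀ k ds d → exitSTN k ds d ≡ STNat (chain k ds) (exit ds d)
    exitSTN-def k ds d = refl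

    totalSTN≡∑chainSTN : ∀ k → totalSTN (2 + k) ≡ ∑ (allSeqs k) (chainSTN k)
    totalSTN≡∑chainSTN k = sum-map (allSeqs k) (chainSTN k)

  chainSTN-snoc : ∀ k (ds : Vec (Fin 3) k) d → chainSTN (suc k) (ds ∷ʳ d) ≡ chainSTN k ds + 15 + 20 * exitSTN k ds d
  chainSTN-snoc k ds d = begin
    chainSTN (suc k) (ds ∷ʳ d)                          ≡⟨ chainSTN-def (suc k) (ds ∷ʳ d) ⟩
    STN (chain (suc k) (ds ∷ʳ d))
      ≡⟨ cong STN {chain (suc k) (ds ∷ʳ d)} {glue (chain k ds) (exit ds d)} (chain-snoc k ds d) ⟩
    STN (glue (chain k ds) (exit ds d))
      ≡⟨ Glue.STN-glue (chain k ds) (exit ds d) (exit<V k ds d) (chain-admissible k ds) ⟩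
    STN (chain k ds) + 15 + 20 * STNat (chain k ds) (exit ds d)
      ≡⟨ cong₂ (λ a b → a + 15 + 20 * b) {STN (chain k ds)} {chainSTN k ds}
               (sym (chainSTN-def k ds)) (sym (exitSTN-def k ds d)) ⟩
    chainSTN k ds + 15 + 20 * exitSTN k ds d            ∎
    where open ≡-Reasoning

  exitSTN-snoc : ∀ k (ds : Vec (Fin 3) k) d d′ →
    exitSTN (suc k) (ds ∷ʳ d) d′ ≡ throughAvoiding d′ + throughContaining d′ * exitSTN k ds d
  exitSTN-snoc k ds d d′ = begin
    exitSTN (suc k) (ds ∷ʳ d) d′                       ≡⟨ exitSTN-def (suc k) (ds ∷ʳ d) d′ ⟩
    STNat (chain (suc k) (ds ∷ʳ d)) (exit (ds ∷ʳ d) d′)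
      ≡⟨ cong₂ STNat {chain (suc k) (ds ∷ʳ d)} {glue (chain k ds) (exit ds d)} {exit (ds ∷ʳ d) d′} {toℕ d′ + V (chain k ds)}
               (chain-snoc k ds d) (exit-snoc k ds d d′) ⟩
    STNat (glue (chain k ds) (exit ds d)) (toℕ d′ + V (chain k ds))
      ≡⟨ Glue.STNat-glue (chain k ds) (exit ds d) (exit<V k ds d) (chain-admissible k ds) d′ ⟩
    throughAvoiding d′ + throughContaining d′ * STNat (chain k ds) (exit ds d)
      ≡⟨ cong (λ b → throughAvoiding d′ + throughContaining d′ * b) {STNat (chain k ds) (exit ds d)} (sym (exitSTN-def k ds d)) ⟩
    throughAvoiding d′ + throughContaining d′ * exitSTN k ds d ∎
    where open ≡-Reasoning

  glue-Hex-STN : STN (glue Hex 0) ≡ STN Hex + 15 + 20 * STNat Hex 0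
  glue-Hex-STN = Glue.STN-glue Hex 0 (s≤s z≤n) Hex-admissible

  glue-Hex-STNat : ∀ d → STNat (glue Hex 0) (toℕ d + V Hex) ≡ throughAvoiding d + throughContaining d * STNat Hex 0
  glue-Hex-STNat = Glue.STNat-glue Hex 0 (s≤s z≤n) Hex-admissible

  chainSTN-[] : chainSTN 0 Vec.[] ≡ 471
  chainSTN-[] = begin
    chainSTN 0 Vec.[]                     ≡⟨ chainSTN-def 0 Vec.[] ⟩
    STN (chain 0 Vec.[])                  ≡⟨ cong STN {chain 0 Vec.[]} {glue Hex 0} chain-[] ⟩
    STN (glue Hex 0)                      ≡⟨ glue-Hex-STN ⟩
    STN Hex + 15 + 20 * STNat Hex 0
      ≡⟨ cong₂ (λ a b → a + 15 + 20 * b) {STN Hex} {36} {STNat Hex 0} {21} Hex-STN Hex-STNat ⟩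
    471                                   ∎
    where open ≡-Reasoning

  exitSTN-[] : ∀ d → exitSTN 0 Vec.[] d ≡ throughAvoiding d + throughContaining d * 21
  exitSTN-[] d = begin
    exitSTN 0 Vec.[] d                    ≡⟨ exitSTN-def 0 Vec.[] d ⟩
    STNat (chain 0 Vec.[]) (exit Vec.[] d)
      ≡⟨ cong₂ STNat {chain 0 Vec.[]} {glue Hex 0} {exit Vec.[] d} {toℕ d + V Hex} chain-[] (+-comm 6 (toℕ d)) ⟩
    STNat (glue Hex 0) (toℕ d + V Hex)    ≡⟨ glue-Hex-STNat d ⟩
    throughAvoiding d + throughContaining d * STNat Hex 0
      ≡⟨ cong (λ b → throughAvoiding d + throughContaining d * b) {STNat Hex 0} {21} Hex-STNat ⟩
    throughAvoiding d + throughContaining d * 21 ∎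
    where open ≡-Reasoning

  codes : List (Fin 3)
  codes = Fin.zero ∷ Fin.suc Fin.zero ∷ Fin.suc (Fin.suc Fin.zero) ∷ []

  ∑-allSeqs-suc : ∀ k (g : Vec (Fin 3) (suc k) → ℕ) →
                  ∑ (allSeqs (suc k)) g ≡ ∑ codes (λ d → ∑ (allSeqs k) (g ∘ (d Vec.∷_)))
  ∑-allSeqs-suc k g = trans (∑-concatMap (λ d → map (d Vec.∷_) (allSeqs k)) codes g)
                            (∑-cong codes (λ d → ∑-map (d Vec.∷_) (allSeqs k) g))

  ∑-allSeqs-snoc : ∀ k (g : Vec (Fin 3) (suc k) → ℕ) →
                   ∑ (allSeqs (suc k)) g ≡ ∑ (allSeqs k) (λ ds → ∑ codes (λ d → g (ds ∷ʳ d)))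
  ∑-allSeqs-snoc zero    g = trans (∑-allSeqs-suc 0 g) (trans (∑-cong codes (λ d → +-identityʳ (g (d Vec.∷ Vec.[]))))
                                                              (sym (+-identityʳ _)))
  ∑-allSeqs-snoc (suc k) g = begin
    ∑ (allSeqs (suc (suc k))) g
      ≡⟨ ∑-allSeqs-suc (suc k) g ⟩
    ∑ codes (λ d → ∑ (allSeqs (suc k)) (g ∘ (d Vec.∷_)))
      ≡⟨ ∑-cong codes (λ d → ∑-allSeqs-snoc k (g ∘ (d Vec.∷_))) ⟩
    ∑ codes (λ d → ∑ (allSeqs k) (λ ds → ∑ codes (λ d′ → g (d Vec.∷ (ds ∷ʳ d′)))))
      ≡⟨ sym (∑-allSeqs-suc k (λ ds → ∑ codes (λ d′ → g (ds ∷ʳ d′)))) ⟩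
    ∑ (allSeqs (suc k)) (λ ds → ∑ codes (λ d′ → g (ds ∷ʳ d′))) ∎
    where open ≡-Reasoning

  ∑-allSeqs-const : ∀ k c → ∑ (allSeqs k) (λ _ → c) ≡ 3 ^ k * c
  ∑-allSeqs-const zero    c = refl
  ∑-allSeqs-const (suc k) c = begin
    ∑ (allSeqs (suc k)) (λ _ → c)        ≡⟨ ∑-allSeqs-suc k (λ _ → c) ⟩
    a + (a + (a + 0))                    ≡⟨ cong (λ z → z + (z + (z + 0))) (∑-allSeqs-const k c) ⟩
    3 ^ k * c + (3 ^ k * c + (3 ^ k * c + 0)) ≡⟨ thrice (3 ^ k) c ⟩
    3 ^ suc k * c                        ∎
    where
    open ≡-Reasoning
    a = ∑ (allSeqs k) (λ _ → c)
    thrice : ∀ p c → p * c + (p * c + (p * c + 0)) ≡ 3 * p * c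
    thrice = solve 2 (λ p c → p :* c :+ (p :* c :+ (p :* c :+ con 0)) := con 3 :* p :* c) refl
      where open +-*-Solver

  stnSum exitSum : ℕ → ℕ
  stnSum  k = ∑ (allSeqs k) (chainSTN k)
  exitSum k = ∑ (allSeqs k) (λ ds → ∑ codes (exitSTN k ds))

  chainSTN-step : ∀ k (ds : Vec (Fin 3) k) →
    ∑ codes (λ d → chainSTN (suc k) (ds ∷ʳ d)) ≡ 3 * chainSTN k ds + 45 + 20 * ∑ codes (exitSTN k ds)
  chainSTN-step k ds = begin
    ∑ codes (λ d → chainSTN (suc k) (ds ∷ʳ d))                 ≡⟨ ∑-cong codes (chainSTN-snoc k ds) ⟩
    ∑ codes (λ d → chainSTN k ds + 15 + 20 * exitSTN k ds d)
      ≡⟨ collect (chainSTN k ds) (exitSTN k ds _) (exitSTN k ds _) (exitSTN k ds _) ⟩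
    3 * chainSTN k ds + 45 + 20 * ∑ codes (exitSTN k ds)        ∎
    where
    open ≡-Reasoning
    collect : ∀ a x y z → (a + 15 + 20 * x) + ((a + 15 + 20 * y) + ((a + 15 + 20 * z) + 0))
                          ≡ 3 * a + 45 + 20 * (x + (y + (z + 0)))
    collect = solve 4 (λ a x y z → (a :+ con 15 :+ con 20 :* x)
                                     :+ ((a :+ con 15 :+ con 20 :* y) :+ ((a :+ con 15 :+ con 20 :* z) :+ con 0))
                                   := con 3 :* a :+ con 45 :+ con 20 :* (x :+ (y :+ (z :+ con 0)))) refl
      where open +-*-Solver

  exitSTN-step : ∀ k (ds : Vec (Fin 3) k) →
    ∑ codes (λ d → ∑ codes (exitSTN (suc k) (ds ∷ʳ d))) ≡ 66 + 41 * ∑ codes (exitSTN k ds)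
  exitSTN-step k ds = begin
    ∑ codes (λ d → ∑ codes (exitSTN (suc k) (ds ∷ʳ d)))
      ≡⟨ ∑-cong codes (λ d → ∑-cong codes (exitSTN-snoc k ds d)) ⟩
    ∑ codes (λ d → ∑ codes (λ d′ → throughAvoiding d′ + throughContaining d′ * exitSTN k ds d))
      ≡⟨ ∑-cong codes (λ d → through-total (exitSTN k ds d)) ⟩
    ∑ codes (λ d → 22 + 41 * exitSTN k ds d)
      ≡⟨ collect (exitSTN k ds _) (exitSTN k ds _) (exitSTN k ds _) ⟩
    66 + 41 * ∑ codes (exitSTN k ds) ∎
    where
    open ≡-Reasoning
    open +-*-Solver
    through-total : ∀ n → ∑ codes (λ d → throughAvoiding d + throughContaining d * n) ≡ 22 + 41 * n
    through-total = solve 1 (λ n → (con 5 :+ con 16 :* n) :+ ((con 8 :+ con 13 :* n) :+ ((con 9 :+ con 12 :* n) :+ con 0))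
                                  := con 22 :+ con 41 :* n) refl
    collect : ∀ x y z → (22 + 41 * x) + ((22 + 41 * y) + ((22 + 41 * z) + 0)) ≡ 66 + 41 * (x + (y + (z + 0)))
    collect = solve 3 (λ x y z → (con 22 :+ con 41 :* x) :+ ((con 22 :+ con 41 :* y) :+ ((con 22 :+ con 41 :* z) :+ con 0))
                                := con 66 :+ con 41 :* (x :+ (y :+ (z :+ con 0)))) refl

  stnSum-suc : ∀ k → stnSum (suc k) ≡ 3 * stnSum k + 45 * 3 ^ k + 20 * exitSum k
  stnSum-suc k = begin
    stnSum (suc k)
      ≡⟨ ∑-allSeqs-snoc k (chainSTN (suc k)) ⟩
    ∑ (allSeqs k) (λ ds → ∑ codes (λ d → chainSTN (suc k) (ds ∷ʳ d)))
      ≡⟨ ∑-cong (allSeqs k) (chainSTN-step k) ⟩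
    ∑ (allSeqs k) (λ ds → 3 * chainSTN k ds + 45 + 20 * ∑ codes (exitSTN k ds))
      ≡⟨ trans (∑-+ (allSeqs k) _ _) (cong (_+ ∑ (allSeqs k) (λ ds → 20 * ∑ codes (exitSTN k ds))) (∑-+ (allSeqs k) _ _)) ⟩
    ∑ (allSeqs k) (λ ds → 3 * chainSTN k ds) + ∑ (allSeqs k) (λ _ → 45)
      + ∑ (allSeqs k) (λ ds → 20 * ∑ codes (exitSTN k ds))
      ≡⟨ cong₂ _+_ (cong₂ _+_ (∑-*ˡ (allSeqs k) 3 (chainSTN k)) (trans (∑-allSeqs-const k 45) (*-comm (3 ^ k) 45)))
                   (∑-*ˡ (allSeqs k) 20 (λ ds → ∑ codes (exitSTN k ds))) ⟩
    3 * stnSum k + 45 * 3 ^ k + 20 * exitSum k ∎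
    where open ≡-Reasoning

  exitSum-suc : ∀ k → exitSum (suc k) ≡ 66 * 3 ^ k + 41 * exitSum k
  exitSum-suc k = begin
    exitSum (suc k)
      ≡⟨ ∑-allSeqs-snoc k (λ ds → ∑ codes (exitSTN (suc k) ds)) ⟩
    ∑ (allSeqs k) (λ ds → ∑ codes (λ d → ∑ codes (exitSTN (suc k) (ds ∷ʳ d))))
      ≡⟨ ∑-cong (allSeqs k) (exitSTN-step k) ⟩
    ∑ (allSeqs k) (λ ds → 66 + 41 * ∑ codes (exitSTN k ds))
      ≡⟨ ∑-+ (allSeqs k) _ _ ⟩
    ∑ (allSeqs k) (λ _ → 66) + ∑ (allSeqs k) (λ ds → 41 * ∑ codes (exitSTN k ds))
      ≡⟨ cong₂ _+_ (trans (∑-allSeqs-const k 66) (*-comm (3 ^ k) 66)) (∑-*ˡ (allSeqs k) 41 (λ ds → ∑ codes (exitSTN k ds))) ⟩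
    66 * 3 ^ k + 41 * exitSum k ∎
    where open ≡-Reasoning

  stnSum-zero : stnSum 0 ≡ 471
  stnSum-zero = trans (+-identityʳ (chainSTN 0 Vec.[])) chainSTN-[]

  exitSum-zero : exitSum 0 ≡ 883
  exitSum-zero = begin
    exitSum 0                                                         ≡⟨ +-identityʳ _ ⟩
    ∑ codes (exitSTN 0 Vec.[])                                        ≡⟨ ∑-cong codes exitSTN-[] ⟩
    ∑ codes (λ d → throughAvoiding d + throughContaining d * 21)      ≡⟨⟩
    883                                                               ∎
    where open ≡-Reasoning

  exitSum-closed : ∀ k → 19 * exitSum k + 11 * 3 ^ suc k ≡ 10 * 41 ^ (2 + k)
  exitSum-closed zero    = cong (λ u → 19 * u + 33) exitSum-zero
  exitSum-closed (suc k) = begin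
    19 * exitSum (suc k) + 11 * 3 ^ (2 + k)              ≡⟨ cong (λ u → 19 * u + 11 * 3 ^ (2 + k)) (exitSum-suc k) ⟩
    19 * (66 * 3 ^ k + 41 * exitSum k) + 11 * (3 * (3 * 3 ^ k))
      ≡⟨ regroup (3 ^ k) (exitSum k) ⟩
    41 * (19 * exitSum k + 11 * (3 * 3 ^ k))             ≡⟨ cong (41 *_) (exitSum-closed k) ⟩
    41 * (10 * 41 ^ (2 + k))                             ≡⟨ *-comm-10 (41 ^ (2 + k)) ⟩
    10 * 41 ^ (3 + k)                                    ∎
    where
    open ≡-Reasoning
    open +-*-Solver
    regroup : ∀ p u → 19 * (66 * p + 41 * u) + 11 * (3 * (3 * p)) ≡ 41 * (19 * u + 11 * (3 * p))
    regroup = solve 2 (λ p u → con 19 :* (con 66 :* p :+ con 41 :* u) :+ con 11 :* (con 3 :* (con 3 :* p))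
                               := con 41 :* (con 19 :* u :+ con 11 :* (con 3 :* p))) refl
    *-comm-10 : ∀ q → 41 * (10 * q) ≡ 10 * (41 * q)
    *-comm-10 = solve 1 (λ q → con 41 :* (con 10 :* q) := con 10 :* (con 41 :* q)) refl

  stnSum-closed : ∀ k → 3249 * stnSum k ≡ 900 * 41 ^ (2 + k) + (1235 * k + 1931) * 3 ^ (2 + k)
  stnSum-closed zero    = cong (3249 *_) stnSum-zero
  stnSum-closed (suc k) = +-cancelʳ-≡ (112860 * 3 ^ k) _ _ (begin
    3249 * stnSum (suc k) + 112860 * 3 ^ k
      ≡⟨ cong (λ t → 3249 * t + 112860 * 3 ^ k) (stnSum-suc k) ⟩
    3249 * (3 * stnSum k + 45 * 3 ^ k + 20 * exitSum k) + 112860 * 3 ^ k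
      ≡⟨ regroup (stnSum k) (3 ^ k) (exitSum k) ⟩
    3 * (3249 * stnSum k) + 146205 * 3 ^ k + 3420 * (19 * exitSum k + 11 * (3 * 3 ^ k))
      ≡⟨ cong₂ (λ a b → 3 * a + 146205 * 3 ^ k + 3420 * b) (stnSum-closed k) (exitSum-closed k) ⟩
    3 * (900 * 41 ^ (2 + k) + (1235 * k + 1931) * (3 * (3 * 3 ^ k))) + 146205 * 3 ^ k + 3420 * (10 * 41 ^ (2 + k))
      ≡⟨ simplify k (3 ^ k) (41 ^ (2 + k)) ⟩
    900 * 41 ^ (3 + k) + (1235 * suc k + 1931) * 3 ^ (3 + k) + 112860 * 3 ^ k ∎)
    where
    open ≡-Reasoning
    open +-*-Solver
    regroup : ∀ t p u → 3249 * (3 * t + 45 * p + 20 * u) + 112860 * p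
                        ≡ 3 * (3249 * t) + 146205 * p + 3420 * (19 * u + 11 * (3 * p))
    regroup = solve 3 (λ t p u → con 3249 :* (con 3 :* t :+ con 45 :* p :+ con 20 :* u) :+ con 112860 :* p
                                 := con 3 :* (con 3249 :* t) :+ con 146205 :* p :+ con 3420 :* (con 19 :* u :+ con 11 :* (con 3 :* p))) refl
    simplify : ∀ k p q → 3 * (900 * q + (1235 * k + 1931) * (3 * (3 * p))) + 146205 * p + 3420 * (10 * q)
                         ≡ 900 * (41 * q) + (1235 * (1 + k) + 1931) * (3 * (3 * (3 * p))) + 112860 * p
    simplify = solve 3 (λ k p q → con 3 :* (con 900 :* q :+ (con 1235 :* k :+ con 1931) :* (con 3 :* (con 3 :* p)))
                                    :+ con 146205 :* p :+ con 3420 :* (con 10 :* q)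
                                 := con 900 :* (con 41 :* q) :+ (con 1235 :* (con 1 :+ k) :+ con 1931) :* (con 3 :* (con 3 :* (con 3 :* p)))
                                    :+ con 112860 :* p) refl


  totalSTN-closed : ∀ k → 3249 * totalSTN (2 + k) + 539 * 3 ^ (2 + k) ≡ 900 * 41 ^ (2 + k) + 1235 * ((2 + k) * 3 ^ (2 + k))
  totalSTN-closed k = begin
    3249 * totalSTN (2 + k) + 539 * 3 ^ (2 + k)
      ≡⟨ cong (λ t → 3249 * t + 539 * 3 ^ (2 + k)) (totalSTN≡∑chainSTN k) ⟩
    3249 * stnSum k + 539 * 3 ^ (2 + k)
      ≡⟨ cong (_+ 539 * 3 ^ (2 + k)) (stnSum-closed k) ⟩
    900 * 41 ^ (2 + k) + (1235 * k + 1931) * 3 ^ (2 + k) + 539 * 3 ^ (2 + k)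
      ≡⟨ regroup k (3 ^ (2 + k)) (41 ^ (2 + k)) ⟩
    900 * 41 ^ (2 + k) + 1235 * ((2 + k) * 3 ^ (2 + k)) ∎
    where
    open ≡-Reasoning
    regroup : ∀ k d p → 900 * p + (1235 * k + 1931) * d + 539 * d ≡ 900 * p + 1235 * ((2 + k) * d)
    regroup = solve 3 (λ k d p → con 900 :* p :+ (con 1235 :* k :+ con 1931) :* d :+ con 539 :* d
                                 := con 900 :* p :+ con 1235 :* ((con 2 :+ k) :* d)) refl
      where open +-*-Solver

-- The average

open import Data.Nat as ℕ using (ℕ; zero; suc; _≥_)
import Data.Nat.Properties as ℕ
open import Data.Integer as ℤ using (+_)
import Data.Integer.Properties as ℤ
open import Data.Integer.Solver using () renaming (module +-*-Solver to ℤ-Solver)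
open import Data.Rational using (ℚ; _/_; _+_; _-_; _*_; 1ℚ; 1/_; NonZero; toℚᵘ)
import Data.Rational.Properties as ℚ
open import Data.Rational.Solver using (module +-*-Solver)
open import Data.Rational.Unnormalised as ℚᵘ using (mkℚᵘ; *≡*)
import Data.Rational.Unnormalised.Properties as ℚᵘ
open import Relation.Binary.PropositionalEquality

ι : ℕ → ℚ
ι n = + n / 1

toℚᵘ-ι : ∀ n → toℚᵘ (ι n) ℚᵘ.≃ mkℚᵘ (+ n) 0
toℚᵘ-ι n = ℚ.toℚᵘ-fromℚᵘ (mkℚᵘ (+ n) 0)

ι-+ : ∀ m n → ι (m ℕ.+ n) ≡ ι m + ι n
ι-+ m n = ℚ.toℚᵘ-injective (ℚᵘ.≃-trans (toℚᵘ-ι (m ℕ.+ n)) (ℚᵘ.≃-trans same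
            (ℚᵘ.≃-sym (ℚᵘ.≃-trans (ℚ.toℚᵘ-homo-+ (ι m) (ι n)) (ℚᵘ.+-cong (toℚᵘ-ι m) (toℚᵘ-ι n))))))
  where
  same : mkℚᵘ (+ (m ℕ.+ n)) 0 ℚᵘ.≃ mkℚᵘ (+ m) 0 ℚᵘ.+ mkℚᵘ (+ n) 0
  same = *≡* (trans (cong (ℤ._* + 1) (ℤ.pos-+ m n))
                    (solve 2 (λ a b → (a :+ b) :* con (+ 1) := (a :* con (+ 1) :+ b :* con (+ 1)) :* con (+ 1)) refl (+ m) (+ n)))
    where open ℤ-Solver

ι-* : ∀ m n → ι (m ℕ.* n) ≡ ι m * ι n
ι-* m n = ℚ.toℚᵘ-injective (ℚᵘ.≃-trans (toℚᵘ-ι (m ℕ.* n)) (ℚᵘ.≃-trans same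
            (ℚᵘ.≃-sym (ℚᵘ.≃-trans (ℚ.toℚᵘ-homo-* (ι m) (ι n)) (ℚᵘ.*-cong (toℚᵘ-ι m) (toℚᵘ-ι n))))))
  where
  same : mkℚᵘ (+ (m ℕ.* n)) 0 ℚᵘ.≃ mkℚᵘ (+ m) 0 ℚᵘ.* mkℚᵘ (+ n) 0
  same = *≡* (cong (ℤ._* + 1) (ℤ.pos-* m n))

ι-/ : ∀ m n .{{_ : ℕ.NonZero n}} → ι n * (+ m / n) ≡ ι m
ι-/ m (suc n) = ℚ.toℚᵘ-injective (ℚᵘ.≃-trans (ℚ.toℚᵘ-homo-* (ι (suc n)) (+ m / suc n))
                  (ℚᵘ.≃-trans (ℚᵘ.*-cong (toℚᵘ-ι (suc n)) (ℚ.toℚᵘ-fromℚᵘ (mkℚᵘ (+ m) n)))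
                              (ℚᵘ.≃-trans same (ℚᵘ.≃-sym (toℚᵘ-ι m)))))
  where
  same : mkℚᵘ (+ suc n) 0 ℚᵘ.* mkℚᵘ (+ m) n ℚᵘ.≃ mkℚᵘ (+ m) 0
  same = *≡* (trans (solve 2 (λ a b → (b :* a) :* con (+ 1) := a :* b) refl (+ m) (+ suc n))
                    (cong (λ z → + m ℤ.* + suc z) (sym (ℕ.+-identityʳ n))))
    where open ℤ-Solver

ι-nonZero : ∀ n .{{_ : ℕ.NonZero n}} → NonZero (ι n)
ι-nonZero (suc n) = ℚ.pos⇒nonZero (ι (suc n)) {{ℚ.normalize-pos (suc n) 1}}

*-cancelˡ : ∀ c .{{_ : NonZero c}} a b → c * a ≡ c * b → a ≡ b
*-cancelˡ c a b e = begin
  a                 ≡⟨ sym (ℚ.*-identityˡ a) ⟩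
  1ℚ * a            ≡⟨ cong (_* a) (sym (ℚ.*-inverseˡ c)) ⟩
  (1/ c * c) * a    ≡⟨ ℚ.*-assoc (1/ c) c a ⟩
  1/ c * (c * a)    ≡⟨ cong (1/ c *_) e ⟩
  1/ c * (c * b)    ≡⟨ sym (ℚ.*-assoc (1/ c) c b) ⟩
  (1/ c * c) * b    ≡⟨ cong (_* b) (ℚ.*-inverseˡ c) ⟩
  1ℚ * b            ≡⟨ ℚ.*-identityˡ b ⟩
  b                 ∎
  where open ≡-Reasoning

^ℚ-ι : ∀ n → ((+ 41) / 3) ^ℚ n * ι (3 ℕ.^ n) ≡ ι (41 ℕ.^ n)
^ℚ-ι zero    = ℚ.*-identityˡ (ι 1)
^ℚ-ι (suc n) = begin
  (q * q ^ℚ n) * ι (3 ℕ.* 3 ℕ.^ n)       ≡⟨ cong ((q * q ^ℚ n) *_) (ι-* 3 (3 ℕ.^ n)) ⟩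
  (q * q ^ℚ n) * (ι 3 * ι (3 ℕ.^ n))     ≡⟨ solve 3 (λ a b c → (a :* b) :* (con (ι 3) :* c) := (a :* con (ι 3)) :* (b :* c))
                                                     refl q (q ^ℚ n) (ι (3 ℕ.^ n)) ⟩
  (q * ι 3) * (q ^ℚ n * ι (3 ℕ.^ n))     ≡⟨ cong (ι 41 *_) (^ℚ-ι n) ⟩
  ι 41 * ι (41 ℕ.^ n)                    ≡⟨ sym (ι-* 41 (41 ℕ.^ n)) ⟩
  ι (41 ℕ.* 41 ℕ.^ n)                    ∎
  where
  open ≡-Reasoning
  open +-*-Solver
  q = (+ 41) / 3

average-from-closed : ∀ k T .{{_ : ℕ.NonZero (3 ℕ.^ k)}} →
  3249 ℕ.* T ℕ.+ 539 ℕ.* 3 ℕ.^ (2 ℕ.+ k) ≡ 900 ℕ.* 41 ℕ.^ (2 ℕ.+ k) ℕ.+ 1235 ℕ.* ((2 ℕ.+ k) ℕ.* 3 ℕ.^ (2 ℕ.+ k)) →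
  (+ T) / 3 ℕ.^ k ≡ ((+ 900) / 361) * (((+ 41) / 3) ^ℚ (2 ℕ.+ k)) + ((+ 130) / 38) * ((+ (2 ℕ.+ k)) / 1) - (+ 539) / 361
average-from-closed k T closed =
  *-cancelˡ c {{ι-nonZero (3249 ℕ.* q) {{ℕ.m*n≢0 3249 q}}}} ((+ T) / q) R
            (trans scaled-average (trans scaled-closed scaled-formula))
  where
  open ≡-Reasoning
  open +-*-Solver
  n q D P : ℕ
  n = 2 ℕ.+ k
  q = 3 ℕ.^ k
  D = 3 ℕ.^ n
  P = 41 ℕ.^ n
  c X R : ℚ
  c = ι (3249 ℕ.* q)
  X = ((+ 41) / 3) ^ℚ n
  R = ((+ 900) / 361) * X + ((+ 130) / 38) * ι n - (+ 539) / 361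

  scaled-average : c * ((+ T) / q) ≡ ι (3249 ℕ.* T)
  scaled-average = begin
    c * ((+ T) / q)                ≡⟨ cong (_* ((+ T) / q)) (ι-* 3249 q) ⟩
    ι 3249 * ι q * ((+ T) / q)     ≡⟨ ℚ.*-assoc (ι 3249) (ι q) ((+ T) / q) ⟩
    ι 3249 * (ι q * ((+ T) / q))   ≡⟨ cong (ι 3249 *_) (ι-/ T q) ⟩
    ι 3249 * ι T                   ≡⟨ sym (ι-* 3249 T) ⟩
    ι (3249 ℕ.* T)                 ∎

  scaled-closed : ι (3249 ℕ.* T) ≡ ι 900 * ι P + ι 1235 * (ι n * ι D) - ι 539 * ι D
  scaled-closed = begin
    ι (3249 ℕ.* T)
      ≡⟨ solve 2 (λ t u → t := t :+ u :- u) refl (ι (3249 ℕ.* T)) (ι (539 ℕ.* D)) ⟩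
    ι (3249 ℕ.* T) + ι (539 ℕ.* D) - ι (539 ℕ.* D)
      ≡⟨ cong (_- ι (539 ℕ.* D)) (sym (ι-+ (3249 ℕ.* T) (539 ℕ.* D))) ⟩
    ι (3249 ℕ.* T ℕ.+ 539 ℕ.* D) - ι (539 ℕ.* D)
      ≡⟨ cong (λ m → ι m - ι (539 ℕ.* D)) closed ⟩
    ι (900 ℕ.* P ℕ.+ 1235 ℕ.* (n ℕ.* D)) - ι (539 ℕ.* D)
      ≡⟨ cong₂ _-_ (trans (ι-+ (900 ℕ.* P) (1235 ℕ.* (n ℕ.* D)))
                          (cong₂ _+_ (ι-* 900 P) (trans (ι-* 1235 (n ℕ.* D)) (cong (ι 1235 *_) (ι-* n D)))))
                   (ι-* 539 D) ⟩
    ι 900 * ι P + ι 1235 * (ι n * ι D) - ι 539 * ι D ∎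

  -- 3249 = 9 · 361 clears the denominators, and 3 ^ n = 9 · q
  scaled-formula : ι 900 * ι P + ι 1235 * (ι n * ι D) - ι 539 * ι D ≡ c * R
  scaled-formula = begin
    ι 900 * ι P + ι 1235 * (ι n * ι D) - ι 539 * ι D
      ≡⟨ cong (λ p → ι 900 * p + ι 1235 * (ι n * ι D) - ι 539 * ι D) (sym (^ℚ-ι n)) ⟩
    ι 900 * (X * ι D) + ι 1235 * (ι n * ι D) - ι 539 * ι D
      ≡⟨ cong (λ d → ι 900 * (X * d) + ι 1235 * (ι n * d) - ι 539 * d)
              (trans (ι-* 3 (3 ℕ.* q)) (cong (ι 3 *_) (ι-* 3 q))) ⟩
    ι 900 * (X * ι9q) + ι 1235 * (ι n * ι9q) - ι 539 * ι9q
      ≡⟨ solve 3 (λ x m r → con (ι 900) :* (x :* (con (ι 3) :* (con (ι 3) :* r)))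
                              :+ con (ι 1235) :* (m :* (con (ι 3) :* (con (ι 3) :* r)))
                              :- con (ι 539) :* (con (ι 3) :* (con (ι 3) :* r))
                            := con (ι 3249) :* r
                                 :* (con ((+ 900) / 361) :* x :+ con ((+ 130) / 38) :* m :- con ((+ 539) / 361)))
                 refl X (ι n) (ι q) ⟩
    ι 3249 * ι q * R
      ≡⟨ cong (_* R) (sym (ι-* 3249 q)) ⟩
    c * R ∎
    where
    ι9q : ℚ
    ι9q = ι 3 * (ι 3 * ι q)

theorem4p2 : ∀ (n : ℕ) → n ≥ 1 →
    STNavr n ≡ ((+ 900) / 361) * (((+ 41) / 3) ^ℚ n) + ((+ 130) / 38) * ((+ n) / 1) - (+ 539) / 361
theorem4p2 (suc zero)    _ = refl
theorem4p2 (suc (suc k)) _ = average-from-closed k (totalSTN (2 ℕ.+ k)) {{ℕ.m^n≢0 3 k}} (Counting.totalSTN-closed k)
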